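{- Fix a real number $\alpha \ge 0$ and an integer $s \ge 1$. For every integer $x \ge 1$, $$S_{4,s,x}^{(\alpha)} = \sum_{r=0}^{s}\sum_{p=0}^{s}\sum_{m=0}^{s} \sum_{k=1}^{x-r} \Biggl( \binom{x-k}{r} B_{s-r,p+1}(m+\alpha; k) - \binom{x+1-k}{r+1}(r+1) B_{s-r,p+1}(m+\alpha-1; k)\Biggr) C_{4,s}(r, p, m)$$ and $$S_{8,s,x}^{(\alpha)} = \sum_{r=0}^{s}\sum_{p=0}^{s}\sum_{w=0}^{s} \sum_{n=0}^{r+1} \sum_{k=1}^{x+1-n} \left(\binom{x+1-n-k+r}{r} \binom{r}{n} - \binom{x+2-n-k+r}{r+1} \binom{r+1}{n}\right) C_{8,s}(r, p, n, w)\, B_{s-r,p+2}(w+\alpha-1; k).$$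
   Context: Notation: $\left[{a \atop b}\right]$ denotes the unsigned Stirling number of the first kind and $\left\{{a \atop b}\right\}$ the Stirling number of the second kind; both are $0$ unless $0 \le b \le a$ (and equal $1$ for $a=b=0$). For an integer $a$ and integer $b \ge 0$, $\binom{a}{b} = a(a-1)\cdots(a-b+1)/b!$, and $\binom{a}{b}=0$ for $b<0$. The convention $0^0=1$ is used. $[q^x]F$ is the coefficient of $q^x$ in a formal power series $F$ in $q$. For real $\beta$ and integers $k \ge 0$, $m \ge 1$, $n \ge 1$, define $B_{k,m}(\beta; n) := \sum_{d \mid n,\ d \le \lfloor n/m \rfloor} \binom{n/d - m + k}{k} d^{\beta}$ (sum over positive divisors $d$ of $n$ with $d \le \lfloor n/m\rfloor$). For integers $0 \le r \le s$ and $p, m \ge 0$: $$C_{4,s}(r,p,m) := \sum_{k=0}^m \binom{s}{r} \left[{s-r \atop m}\right] \left\{{m \atop k}\right\} \binom{s-r-k}{p} (-1)^{s-r-k+p} k!\, r!.$$ For integers $0 \le r \le s$, $0 \le n \le r+1$, $p, w \ge 0$: $$C_{8,s}(r,p,n,w) := \sum_{m=0}^{s-r} \sum_{k=0}^m \sum_{m_1=0}^{r+1-n} \sum_{m_2=0}^n \binom{s}{r} \left[{s-r \atop m}\right] \left\{{m \atop k}\right\} \binom{s-r-k}{p} \left[{r+1-n \atop m_1}\right] \left[{n \atop m_2}\right] \binom{m_2}{w-m-m_1} (-1)^{s-k+p+n+m_1+m_2} k!\, (n-2-r)^{m+m_1+m_2-w}.$$ For each integer $i \ge 1$, define the formal power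 series in $q$ $$\mathrm{Sum}_{4,s}(q,i) := \sum_{r=0}^s\sum_{p=0}^s\sum_{m=0}^s \frac{q^{(p+1)i+r}}{(1-q^i)^{s-r+1}} \left( \frac{i^{m+1}}{(1-q)^{r+1}} - \frac{(r+1) i^m}{(1-q)^{r+2}} \right) C_{4,s}(r,p,m),$$ $$\mathrm{Sum}_{8,s}(q,i) := \sum_{r=0}^s\sum_{p=0}^s \sum_{n=0}^{r+1} \sum_{w=0}^s \frac{q^{(p+2)i+n-1}}{(1-q^i)^{s-r+1}} \left( \binom{r}{n} \frac{1}{(1-q)^{r+1}} - \binom{r+1}{n} \frac{1}{(1-q)^{r+2}} \right) i^w C_{8,s}(r,p,n,w),$$ and set $S_{4,s,x}^{(\alpha)} := [q^x] \sum_{i \ge 1} \mathrm{Sum}_{4,s}(q,i)\, i^{\alpha-1}$ and $S_{8,s,x}^{(\alpha)} := [q^x] \sum_{i \ge 1} \mathrm{Sum}_{8,s}(q,i)\, i^{\alpha-1}$. -}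

module Defs where

open import Level using (Level)
open import Data.Nat as N using (ℕ; zero; suc; _∸_; _!; NonZero)
open import Data.Nat.Properties using (_!≢0)
open import Data.Nat.Divisibility using (_∣?_)
open import Data.Integer as Z using (ℤ; +_; -[1+_])
open import Relation.Nullary using (yes; no)
open import Relation.Nullary.Decidable using (_×-dec_)
open import Data.Product using (_,_)
open import Algebra.Bundles using (CommutativeRing)

sumℤ : ℕ → (ℕ → ℤ) → ℤ
sumℤ zero    f = + 0
sumℤ (suc n) f = sumℤ n f Z.+ f n

fallingℤ : ℤ → ℕ → ℤ
fallingℤ a zero    = + 1
fallingℤ a (suc b) = fallingℤ a b Z.* (a Z.- + b)

-- binomial coefficient with integer top, natural bottom:
-- a(a-1)...(a-b+1)/b!   (exact division)
binom : ℤ → ℕ → ℤ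
binom a b = _/ℕ_ (fallingℤ a b) (b !) {{b !≢0}}
  where open Z using (_/ℕ_)

binomZ : ℤ → ℤ → ℤ
binomZ a (+ b)    = binom a b
binomZ a -[1+ b ] = + 0

-- unsigned Stirling numbers of the first kind  [a b]
stir1 : ℕ → ℕ → ℤ
stir1 zero    zero    = + 1
stir1 zero    (suc k) = + 0
stir1 (suc n) zero    = + 0
stir1 (suc n) (suc k) = + n Z.* stir1 n (suc k) Z.+ stir1 n k

stir2 : ℕ → ℕ → ℤ
stir2 zero    zero    = + 1
stir2 zero    (suc k) = + 0
stir2 (suc n) zero    = + 0
stir2 (suc n) (suc k) = + (suc k) Z.* stir2 n (suc k) Z.+ stir2 n k

signPow : ℤ → ℤ
signPow e with Z.∣ e ∣ N.% 2
... | zero = + 1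
... | suc _ = Z.- (+ 1)

-- a^e for integer exponent e; only used where the exponent is >= 0 or the
-- term carries a vanishing binomial factor; 0 for e < 0.
powZ : ℤ → ℤ → ℤ
powZ a (+ e)    = a Z.^ e
powZ a -[1+ e ] = + 0

C4 : ℕ → ℕ → ℕ → ℕ → ℤ
C4 s r p m = sumℤ (suc m) λ k →
  binom (+ s) r Z.* stir1 (s ∸ r) m Z.* stir2 m k
    Z.* binom (+ s Z.- + r Z.- + k) p
    Z.* signPow (+ s Z.- + r Z.- + k Z.+ + p)
    Z.* + (k !) Z.* + (r !)

C8 : ℕ → ℕ → ℕ → ℕ → ℕ → ℤ
C8 s r p n w =
  sumℤ (suc (s ∸ r)) λ m →
  sumℤ (suc m) λ k →
  sumℤ (suc (suc r ∸ n)) λ m₁ →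
  sumℤ (suc n) λ m₂ →
    binom (+ s) r Z.* stir1 (s ∸ r) m Z.* stir2 m k
    Z.* binom (+ s Z.- + r Z.- + k) p
    Z.* stir1 (suc r ∸ n) m₁ Z.* stir1 n m₂
    Z.* binomZ (+ m₂) (+ w Z.- + m Z.- + m₁)
    Z.* signPow (+ s Z.- + k Z.+ + p Z.+ + n Z.+ + m₁ Z.+ + m₂)
    Z.* + (k !)
    Z.* powZ (+ n Z.- + 2 Z.- + r) (+ m Z.+ + m₁ Z.+ + m₂ Z.- + w)

-- Ring-valued part.  The real weight d ↦ d^(α-1) is replaced by an
-- arbitrary weight g : ℕ → R.

module _ {c ℓ : Level} (R : CommutativeRing c ℓ) where
  open CommutativeRing R

  natR : ℕ → Carrier
  natR zero    = 0#
  natR (suc n) = 1# + natR n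

  ι : ℤ → Carrier
  ι (+ n)    = natR n
  ι -[1+ n ] = - natR (suc n)

  sumR : ℕ → (ℕ → Carrier) → Carrier
  sumR zero    f = 0#
  sumR (suc n) f = sumR n f + f n

  powR : Carrier → ℕ → Carrier
  powR a zero    = 1#
  powR a (suc e) = powR a e * a

  -- B_{k,m}(j+α-1; n) with d^(α-1) replaced by g d:
  --   Σ_{d ∣ n, 1 ≤ d ≤ ⌊n/m⌋} binom(n/d - m + k, k) d^j g(d)
  Bg : (g : ℕ → Carrier) (k m : ℕ) .{{_ : NonZero m}} (j n : ℕ) → Carrier
  Bg g k m j n = sumR n term
    where
    -- the divisor d = suc d′ ranges over 1..n
    term : ℕ → Carrier
    term d′ with (suc d′ ∣? n) ×-dec (suc d′ N.≤? (n N./ m))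
    ... | yes _ = ι (binom (+ (n N./ suc d′) Z.- + m Z.+ + k) k)
                    * powR (natR (suc d′)) j * g (suc d′)
    ... | no _  = 0#

  FPS : Set c
  FPS = ℕ → Carrier

  coeff : ℕ → FPS → Carrier
  coeff x F = F x

  infixl 6 _⊕_ _⊖_
  infixl 7 _⊗_
  infixr 8 _·ₛ_

  _⊕_ : FPS → FPS → FPS
  (F ⊕ G) n = F n + G n

  _⊖_ : FPS → FPS → FPS
  (F ⊖ G) n = F n - G n

  _·ₛ_ : Carrier → FPS → FPS
  (a ·ₛ F) n = a * F n

  _⊗_ : FPS → FPS → FPS
  (F ⊗ G) n = sumR (suc n) λ j → F j * G (n ∸ j)

  qPow : ℕ → FPS
  qPow a n with n N.≟ a
  ... | yes _ = 1#
  ... | no _  = 0#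

  oneS : FPS
  oneS = qPow 0

  powS : FPS → ℕ → FPS
  powS F zero    = oneS
  powS F (suc e) = powS F e ⊗ F

  -- geometric series Σ_j u^j = 1/(1-u), for u with zero constant term
  -- (then only j ≤ n contribute to the coefficient of q^n)
  geomS : FPS → FPS
  geomS u n = sumR (suc n) λ j → powS u j n

  -- multiplicative inverse of a series F with constant term 1:
  -- 1/F = 1/(1 - (1 - F))
  recipS : FPS → FPS
  recipS F = geomS (oneS ⊖ F)

  sumS : ℕ → (ℕ → FPS) → FPS
  sumS n F x = sumR n λ j → F j x

  Sum4 : ℕ → ℕ → FPS
  Sum4 s i =
    sumS (suc s) λ r → sumS (suc s) λ p → sumS (suc s) λ m →
      ι (C4 s r p m) ·ₛ
      (qPow (suc p N.* i N.+ r)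
       ⊗ recipS (powS (oneS ⊖ qPow i) (suc (s ∸ r)))
       ⊗ ((powR (natR i) (suc m) ·ₛ recipS (powS (oneS ⊖ qPow 1) (suc r)))
          ⊖ ((natR (suc r) * powR (natR i) m)
               ·ₛ recipS (powS (oneS ⊖ qPow 1) (suc (suc r))))))

  Sum8 : ℕ → ℕ → FPS
  Sum8 s i =
    sumS (suc s) λ r → sumS (suc s) λ p → sumS (suc (suc r)) λ n →
    sumS (suc s) λ w →
      (powR (natR i) w * ι (C8 s r p n w)) ·ₛ
      (qPow ((suc (suc p) N.* i N.+ n) ∸ 1)
       ⊗ recipS (powS (oneS ⊖ qPow i) (suc (s ∸ r)))
       ⊗ ((ι (binom (+ r) n) ·ₛ recipS (powS (oneS ⊖ qPow 1) (suc r)))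
          ⊖ (ι (binom (+ suc r) n)
               ·ₛ recipS (powS (oneS ⊖ qPow 1) (suc (suc r))))))

  -- partial sums  [q^x] Σ_{i=1}^{N} Sum_{·,s}(q,i) · g(i),
  -- where g(i) stands for i^(α-1)
  S4partial : (g : ℕ → Carrier) (s N x : ℕ) → Carrier
  S4partial g s N x = coeff x (sumS N λ i′ → g (suc i′) ·ₛ Sum4 s (suc i′))

  S8partial : (g : ℕ → Carrier) (s N x : ℕ) → Carrier
  S8partial g s N x = coeff x (sumS N λ i′ → g (suc i′) ·ₛ Sum8 s (suc i′))

  RHS4 : (g : ℕ → Carrier) (s x : ℕ) → Carrier
  RHS4 g s x =
    sumR (suc s) λ r → sumR (suc s) λ p → sumR (suc s) λ m →
    sumR (x ∸ r) λ k′ →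
      let k = suc k′ in
      (  ι (binom (+ x Z.- + k) r) * Bg g (s ∸ r) (suc p) (suc m) k
       - ι (binom (+ x Z.+ + 1 Z.- + k) (suc r) Z.* + suc r)
           * Bg g (s ∸ r) (suc p) m k)
      * ι (C4 s r p m)

  RHS8 : (g : ℕ → Carrier) (s x : ℕ) → Carrier
  RHS8 g s x =
    sumR (suc s) λ r → sumR (suc s) λ p → sumR (suc s) λ w →
    sumR (suc (suc r)) λ n →
    sumR (suc x ∸ n) λ k′ →
      let k = suc k′ in
      ι (  binom (+ x Z.+ + 1 Z.- + n Z.- + k Z.+ + r) r Z.* binom (+ r) n
         Z.- binom (+ x Z.+ + 2 Z.- + n Z.- + k Z.+ + r) (suc r)
             Z.* binom (+ suc r) n)
      * ι (C8 s r p n w)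
      * Bg g (s ∸ r) (suc (suc p)) w k

module Submission where

-- Since 1/(1 - q^i)^(K+1) = Σ_{i ∣ n} C(n/i + K, K) q^n, the coefficient of q^y in
-- q^(a i)/(1 - q^i)^(K+1) is C(y/i - a + K, K) when i ∣ y and i ≤ y/a, and 0 otherwise.
-- Weighted by i^e g(i) and summed over i, these coefficients give exactly the divisor sum
-- B_{K,a}(e; y); all i > y contribute 0, so every partial sum over i ≤ N with N ≥ y is
-- already exact. Multiplying further by q^(t-1) and by 1/(1 - q)^(r+1), whose coefficients
-- are C(n + r, r), makes the coefficient of q^x a convolution Σ_k B(k) C(x - k - t + 1 + r, r),
-- and both identities follow by linearity once N > x.

open import Defs using (fallingℤ; binom; S4partial; S8partial; RHS4; RHS8)
import Defs as D
open import Level using (Level)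
open import Data.Nat as ℕ using (ℕ; zero; suc; _≤_; _<_; z≤n; s≤s; _∸_; _!; _≤?_; NonZero)
import Data.Nat.Properties as ℕₚ
open import Data.Nat.Combinatorics using (_C_; nCk≡nPk/k!; k>n⇒nCk≡0; nCn≡1; nCk+nC[k+1]≡[n+1]C[k+1])
open import Data.Nat.Combinatorics.Base using (_P′_; _P_)
open import Data.Nat.Divisibility using (_∣_; _∣?_; ∣-refl; _∣0; 1∣_; ∣⇒≤; n∣m*n; ∣m+n∣m⇒∣n; ∣m∸n∣n⇒∣m)
open import Data.Nat.DivMod
  using (_/_; 0/n≡0; n/1≡n; m/n*n≤m; m*n/n≡m; /-monoˡ-≤; m≥n⇒m/n>0; [m∸n]/n≡m/n∸1; [m∸n*o]/o≡m/o∸n)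
open import Data.Nat.Induction using (<-rec)
open import Data.Integer as ℤ using (ℤ; +_)
import Data.Integer.Properties as ℤₚ
open import Data.Integer.Tactic.RingSolver using (solve-∀)
open import Data.Product using (_×_; ∃; _,_)
open import Data.Sum using (inj₁; inj₂)
open import Data.Empty using (⊥-elim)
open import Data.Bool using (true)
open import Relation.Nullary using (Dec; yes; no; ¬_)
open import Relation.Nullary.Decidable using (_×-dec_)
open import Relation.Binary.PropositionalEquality as ≡ using (_≡_; _≢_)
open import Algebra.Bundles using (CommutativeRing)

+[m∸n]≡+m-+n : ∀ {m n} → n ≤ m → + (m ∸ n) ≡ + m ℤ.- + n
+[m∸n]≡+m-+n {m} {n} n≤m = ≡.sym (≡.trans (ℤₚ.[+m]-[+n]≡m⊖n m n) (ℤₚ.⊖-≥ n≤m))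

fallingℤ-≤ : ∀ {n k} → k ≤ n → fallingℤ (+ n) k ≡ + (n P′ k)
fallingℤ-≤ {n} {zero}  _    = ≡.refl
fallingℤ-≤ {n} {suc k} k<n = begin
  fallingℤ (+ n) k ℤ.* (+ n ℤ.- + k) ≡⟨ ≡.cong₂ ℤ._*_ (fallingℤ-≤ k≤n) (≡.sym (+[m∸n]≡+m-+n k≤n)) ⟩
  + (n P′ k) ℤ.* + (n ∸ k)           ≡⟨ ≡.sym (ℤₚ.pos-* (n P′ k) (n ∸ k)) ⟩
  + ((n P′ k) ℕ.* (n ∸ k))           ≡⟨ ≡.cong +_ (ℕₚ.*-comm (n P′ k) (n ∸ k)) ⟩
  + (n P′ suc k)                     ∎
  where
  open ≡.≡-Reasoning
  k≤n : k ≤ n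
  k≤n = ℕₚ.<⇒≤ k<n

-- The factor n - n kills the falling factorial from k = n + 1 on.
fallingℤ-> : ∀ {n k} → n < k → fallingℤ (+ n) k ≡ + 0
fallingℤ-> {n} {suc k} n<1+k with ℕₚ.m≤n⇒m<n∨m≡n (ℕₚ.≤-pred n<1+k)
... | inj₁ n<k    = ≡.trans (≡.cong (ℤ._* (+ n ℤ.- + k)) (fallingℤ-> n<k)) (ℤₚ.*-zeroˡ (+ n ℤ.- + k))
... | inj₂ ≡.refl = ≡.trans (≡.cong (fallingℤ (+ n) n ℤ.*_) (ℤₚ.+-inverseʳ (+ n))) (ℤₚ.*-zeroʳ (fallingℤ (+ n) n))

nPk≡nP′k : ∀ {n k} → k ≤ n → n P k ≡ n P′ k
nPk≡nP′k {n} {k} k≤n with k ℕ.≤ᵇ n | ℕₚ.≤⇒≤ᵇ k≤n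
... | true | _ = ≡.refl

binom-pos : ∀ n k → binom (+ n) k ≡ + (n C k)
binom-pos n k with k ≤? n
... | yes k≤n = begin
  ℤ._/ℕ_ (fallingℤ (+ n) k) (k !) {{k ℕₚ.!≢0}} ≡⟨ ≡.cong (λ z → ℤ._/ℕ_ z (k !) {{k ℕₚ.!≢0}}) (fallingℤ-≤ k≤n) ⟩
  + ((n P′ k) / k !) {{k ℕₚ.!≢0}}            ≡⟨ ≡.cong (λ z → + (z / k !) {{k ℕₚ.!≢0}}) (≡.sym (nPk≡nP′k k≤n)) ⟩
  + ((n P k) / k !) {{k ℕₚ.!≢0}}             ≡⟨ ≡.cong +_ (≡.sym (nCk≡nPk/k! k≤n)) ⟩
  + (n C k)                                  ∎
  where open ≡.≡-Reasoning
... | no k≰n = begin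
  ℤ._/ℕ_ (fallingℤ (+ n) k) (k !) {{k ℕₚ.!≢0}}
    ≡⟨ ≡.cong (λ z → ℤ._/ℕ_ z (k !) {{k ℕₚ.!≢0}}) (fallingℤ-> (ℕₚ.≰⇒> k≰n)) ⟩
  + (0 / k !) {{k ℕₚ.!≢0}}                   ≡⟨ ≡.cong +_ (0/n≡0 (k !) {{k ℕₚ.!≢0}}) ⟩
  + 0                                        ≡⟨ ≡.cong +_ (≡.sym (k>n⇒nCk≡0 (ℕₚ.≰⇒> k≰n))) ⟩
  + (n C k)                                  ∎
  where open ≡.≡-Reasoning

binom*binom≡+ : ∀ {z} a b k l → z ≡ + a → binom z k ℤ.* binom (+ b) l ≡ + ((a C k) ℕ.* (b C l))
binom*binom≡+ a b k l z≡a =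
  ≡.trans (≡.cong₂ ℤ._*_ (≡.trans (≡.cong (λ z → binom z k) z≡a) (binom-pos a k)) (binom-pos b l))
          (≡.sym (ℤₚ.pos-* (a C k) (b C l)))

∣n⇒∣n∸m : ∀ {d m n} → d ∣ m → m ≤ n → d ∣ n → d ∣ n ∸ m
∣n⇒∣n∸m d∣m m≤n d∣n = ∣m+n∣m⇒∣n (≡.subst (_ ∣_) (≡.sym (ℕₚ.m+[n∸m]≡n m≤n)) d∣n) d∣m

∣n∸m⇒∣n : ∀ {d m n} → d ∣ m → m ≤ n → d ∣ n ∸ m → d ∣ n
∣n∸m⇒∣n {d} d∣m m≤n d∣n∸m = ∣m∸n∣n⇒∣m d m≤n d∣n∸m d∣m

m*o≤n⇒m≤n/o : ∀ {m n o} .{{_ : NonZero o}} → m ℕ.* o ≤ n → m ≤ n / o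
m*o≤n⇒m≤n/o {m} {n} {o} m*o≤n = ≡.subst (_≤ n / o) (m*n/n≡m m o) (/-monoˡ-≤ o m*o≤n)

m≤n/o⇒m*o≤n : ∀ {m n o} .{{_ : NonZero o}} → m ≤ n / o → m ℕ.* o ≤ n
m≤n/o⇒m*o≤n {m} {n} {o} m≤n/o = ℕₚ.≤-trans (ℕₚ.*-monoˡ-≤ o m≤n/o) (m/n*n≤m n o)

m<n∸o⇒m+o<n : ∀ {m n o} → m < n ∸ o → m ℕ.+ o < n
m<n∸o⇒m+o<n {m} {n} {o} m<n∸o with o ≤? n
... | yes o≤n = ℕₚ.m≤o∸n⇒m+n≤o (suc m) o≤n m<n∸o
... | no o≰n  = ⊥-elim (ℕₚ.n≮0 (≡.subst (m <_) (ℕₚ.m≤n⇒m∸n≡0 (ℕₚ.<⇒≤ (ℕₚ.≰⇒> o≰n))) m<n∸o))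

module _ {r₁ r₂ : Level} (R : CommutativeRing r₁ r₂) where
  open CommutativeRing R
  open import Relation.Binary.Reasoning.Setoid setoid
  open import Algebra.Properties.Ring ring using (x[y-z]≈xy-xz; [y-z]x≈yx-zx)
  open import Algebra.Properties.AbelianGroup +-abelianGroup using (⁻¹-∙-comm; ε⁻¹≈ε; ⁻¹-anti-homo‿-)
  open import Algebra.Properties.CommutativeSemigroup +-commutativeSemigroup using (interchange)
  open import Algebra.Properties.Semiring.Mult semiring using (×-homo-+; ×1-homo-*) renaming (_×_ to _×ₙ_)
  open import Algebra.Solver.CommutativeMonoid *-commutativeMonoid using (_⊜_) renaming (solve to *-solve; _⊕_ to _∙_)

  ∑ : ℕ → (ℕ → Carrier) → Carrier
  ∑ = D.sumR R

  natR : ℕ → Carrier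
  natR = D.natR R

  ι : ℤ → Carrier
  ι = D.ι R

  ≡⇒≈ : ∀ {a b} → a ≡ b → a ≈ b
  ≡⇒≈ ≡.refl = refl

  -0#≈0# : - 0# ≈ 0#
  -0#≈0# = ε⁻¹≈ε

  x-0#≈x : ∀ x → x - 0# ≈ x
  x-0#≈x x = trans (+-congˡ -0#≈0#) (+-identityʳ x)

  x+y-y≈x : ∀ x y → (x + y) - y ≈ x
  x+y-y≈x x y = trans (+-assoc x y (- y)) (trans (+-congˡ (-‿inverseʳ y)) (+-identityʳ x))

  -‿distrib-+ : ∀ x y → - (x + y) ≈ - x + - y
  -‿distrib-+ x y = sym (⁻¹-∙-comm x y)

  natR≈×1# : ∀ n → natR n ≈ n ×ₙ 1#
  natR≈×1# zero    = refl
  natR≈×1# (suc n) = +-congˡ (natR≈×1# n)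

  natR-+ : ∀ m n → natR (m ℕ.+ n) ≈ natR m + natR n
  natR-+ m n = begin
    natR (m ℕ.+ n)      ≈⟨ natR≈×1# (m ℕ.+ n) ⟩
    (m ℕ.+ n) ×ₙ 1#     ≈⟨ ×-homo-+ 1# m n ⟩
    m ×ₙ 1# + n ×ₙ 1#   ≈⟨ +-cong (natR≈×1# m) (natR≈×1# n) ⟨
    natR m + natR n     ∎

  natR-* : ∀ m n → natR (m ℕ.* n) ≈ natR m * natR n
  natR-* m n = begin
    natR (m ℕ.* n)          ≈⟨ natR≈×1# (m ℕ.* n) ⟩
    (m ℕ.* n) ×ₙ 1#         ≈⟨ ×1-homo-* m n ⟩
    (m ×ₙ 1#) * (n ×ₙ 1#)   ≈⟨ *-cong (natR≈×1# m) (natR≈×1# n) ⟨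
    natR m * natR n         ∎

  natR-∸ : ∀ {m n} → n ≤ m → natR (m ∸ n) ≈ natR m - natR n
  natR-∸ {m} {n} n≤m = begin
    natR (m ∸ n)                     ≈⟨ x+y-y≈x _ _ ⟨
    natR (m ∸ n) + natR n - natR n   ≈⟨ +-congʳ (natR-+ (m ∸ n) n) ⟨
    natR (m ∸ n ℕ.+ n) - natR n      ≈⟨ +-congʳ (≡⇒≈ (≡.cong natR (ℕₚ.m∸n+n≡m n≤m))) ⟩
    natR m - natR n                  ∎

  ι[+m-+n] : ∀ m n → ι (+ m ℤ.- + n) ≈ natR m - natR n
  ι[+m-+n] m n with n ≤? m
  ... | yes n≤m = trans (≡⇒≈ (≡.cong ι (≡.sym (+[m∸n]≡+m-+n n≤m)))) (natR-∸ n≤m)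
  ... | no n≰m  = begin
    ι (+ m ℤ.- + n)            ≈⟨ ≡⇒≈ (≡.cong ι (≡.trans (ℤₚ.[+m]-[+n]≡m⊖n m n) (ℤₚ.⊖-< m<n))) ⟩
    ι (ℤ.- + (n ∸ m))          ≈⟨ ι-neg (n ∸ m) ⟩
    - natR (n ∸ m)             ≈⟨ -‿cong (natR-∸ (ℕₚ.<⇒≤ m<n)) ⟩
    - (natR n - natR m)        ≈⟨ ⁻¹-anti-homo‿- (natR n) (natR m) ⟩
    natR m - natR n            ∎
    where
    m<n : m < n
    m<n = ℕₚ.≰⇒> n≰m
    ι-neg : ∀ k → ι (ℤ.- + k) ≈ - natR k
    ι-neg zero    = sym -0#≈0#
    ι-neg (suc k) = refl

  ι-binom : ∀ {z} n k → z ≡ + n → ι (binom z k) ≈ natR (n C k)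
  ι-binom n k z≡n = ≡⇒≈ (≡.cong ι (≡.trans (≡.cong (λ z → binom z k) z≡n) (binom-pos n k)))

  -- Finite sums

  ∑-cong : ∀ n {f h : ℕ → Carrier} → (∀ i → i < n → f i ≈ h i) → ∑ n f ≈ ∑ n h
  ∑-cong zero    f≈h = refl
  ∑-cong (suc n) f≈h = +-cong (∑-cong n (λ i i<n → f≈h i (ℕₚ.m<n⇒m<1+n i<n))) (f≈h n ℕₚ.≤-refl)

  ∑-cong-∀ : ∀ n {f h : ℕ → Carrier} → (∀ i → f i ≈ h i) → ∑ n f ≈ ∑ n h
  ∑-cong-∀ n f≈h = ∑-cong n (λ i _ → f≈h i)

  ∑-zero : ∀ n {f : ℕ → Carrier} → (∀ i → i < n → f i ≈ 0#) → ∑ n f ≈ 0#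
  ∑-zero n f≈0 = trans (∑-cong n f≈0) (∑-0# n)
    where
    ∑-0# : ∀ n → ∑ n (λ _ → 0#) ≈ 0#
    ∑-0# zero    = refl
    ∑-0# (suc n) = trans (+-identityʳ _) (∑-0# n)

  ∑-distrib-+ : ∀ n (f h : ℕ → Carrier) → ∑ n (λ i → f i + h i) ≈ ∑ n f + ∑ n h
  ∑-distrib-+ zero    f h = sym (+-identityʳ 0#)
  ∑-distrib-+ (suc n) f h = trans (+-congʳ (∑-distrib-+ n f h)) (interchange _ _ _ _)

  ∑-distribˡ : ∀ n x (f : ℕ → Carrier) → x * ∑ n f ≈ ∑ n (λ i → x * f i)
  ∑-distribˡ zero    x f = zeroʳ x
  ∑-distribˡ (suc n) x f = trans (distribˡ x _ _) (+-congʳ (∑-distribˡ n x f))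

  ∑-distribʳ : ∀ n x (f : ℕ → Carrier) → ∑ n f * x ≈ ∑ n (λ i → f i * x)
  ∑-distribʳ n x f = trans (*-comm _ x) (trans (∑-distribˡ n x f) (∑-cong-∀ n (λ i → *-comm x (f i))))

  -‿distrib-∑ : ∀ n (f : ℕ → Carrier) → - ∑ n f ≈ ∑ n (λ i → - f i)
  -‿distrib-∑ zero    f = -0#≈0#
  -‿distrib-∑ (suc n) f = trans (-‿distrib-+ _ _) (+-congʳ (-‿distrib-∑ n f))

  ∑-distrib-- : ∀ n (f h : ℕ → Carrier) → ∑ n (λ i → f i - h i) ≈ ∑ n f - ∑ n h
  ∑-distrib-- n f h = trans (∑-distrib-+ n f (λ i → - h i)) (+-congˡ (sym (-‿distrib-∑ n h)))

  ∑-linear : ∀ n x y (f h : ℕ → Carrier) → ∑ n (λ i → x * f i - y * h i) ≈ x * ∑ n f - y * ∑ n h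
  ∑-linear n x y f h = trans (∑-distrib-- n _ _) (sym (+-cong (∑-distribˡ n x f) (-‿cong (∑-distribˡ n y h))))

  ∑-comm : ∀ m n (f : ℕ → ℕ → Carrier) → ∑ m (λ i → ∑ n (f i)) ≈ ∑ n (λ j → ∑ m (λ i → f i j))
  ∑-comm zero    n f = sym (∑-zero n (λ _ _ → refl))
  ∑-comm (suc m) n f = trans (+-congʳ (∑-comm m n f)) (sym (∑-distrib-+ n _ _))

  ∑-distribˡ-∑ : ∀ m n (x : ℕ → Carrier) (f : ℕ → ℕ → Carrier) →
    ∑ m (λ i → x i * ∑ n (f i)) ≈ ∑ n (λ j → ∑ m (λ i → x i * f i j))
  ∑-distribˡ-∑ m n x f = trans (∑-cong-∀ m (λ i → ∑-distribˡ n (x i) (f i))) (∑-comm m n _)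

  ∑-distribˡ-∑-cong : ∀ m n (x : ℕ → Carrier) (f : ℕ → ℕ → Carrier) (h : ℕ → Carrier) →
    (∀ j → ∑ m (λ i → x i * f i j) ≈ h j) → ∑ m (λ i → x i * ∑ n (f i)) ≈ ∑ n h
  ∑-distribˡ-∑-cong m n x f h pulled = trans (∑-distribˡ-∑ m n x f) (∑-cong-∀ n pulled)

  ∑-head : ∀ n (f : ℕ → Carrier) → ∑ (suc n) f ≈ f 0 + ∑ n (λ i → f (suc i))
  ∑-head zero    f = trans (+-identityˡ _) (sym (+-identityʳ _))
  ∑-head (suc n) f = trans (+-congʳ (∑-head n f)) (+-assoc _ _ _)

  ∑-reverse : ∀ n (f : ℕ → Carrier) → ∑ n f ≈ ∑ n (λ i → f (n ∸ suc i))
  ∑-reverse zero    f = refl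
  ∑-reverse (suc n) f = begin
    ∑ n f + f n                        ≈⟨ +-comm _ _ ⟩
    f n + ∑ n f                        ≈⟨ +-congˡ (∑-reverse n f) ⟩
    f n + ∑ n (λ i → f (n ∸ suc i))    ≈⟨ sym (∑-head n (λ i → f (n ∸ i))) ⟩
    ∑ (suc n) (λ i → f (n ∸ i))        ∎

  ∑-split : ∀ m n (f : ℕ → Carrier) → ∑ (m ℕ.+ n) f ≈ ∑ m f + ∑ n (λ i → f (m ℕ.+ i))
  ∑-split m zero    f = trans (≡⇒≈ (≡.cong (λ k → ∑ k f) (ℕₚ.+-identityʳ m))) (sym (+-identityʳ _))
  ∑-split m (suc n) f = begin
    ∑ (m ℕ.+ suc n) f                                   ≈⟨ ≡⇒≈ (≡.cong (λ k → ∑ k f) (ℕₚ.+-suc m n)) ⟩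
    ∑ (m ℕ.+ n) f + f (m ℕ.+ n)                         ≈⟨ +-congʳ (∑-split m n f) ⟩
    (∑ m f + ∑ n (λ i → f (m ℕ.+ i))) + f (m ℕ.+ n)     ≈⟨ +-assoc _ _ _ ⟩
    ∑ m f + (∑ n (λ i → f (m ℕ.+ i)) + f (m ℕ.+ n))     ∎

  ∑-dropZeros : ∀ m n (f : ℕ → Carrier) → (∀ i → i < m → f i ≈ 0#) → ∑ (m ℕ.+ n) f ≈ ∑ n (λ i → f (m ℕ.+ i))
  ∑-dropZeros m n f f≈0 = trans (∑-split m n f) (trans (+-congʳ (∑-zero m f≈0)) (+-identityˡ _))

  ∑-extend : ∀ m n (f : ℕ → Carrier) → m ≤ n → (∀ i → m ≤ i → i < n → f i ≈ 0#) → ∑ n f ≈ ∑ m f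
  ∑-extend m n f m≤n f≈0 = begin
    ∑ n f                                       ≈⟨ ≡⇒≈ (≡.cong (λ k → ∑ k f) (≡.sym (ℕₚ.m+[n∸m]≡n m≤n))) ⟩
    ∑ (m ℕ.+ (n ∸ m)) f                         ≈⟨ ∑-split m (n ∸ m) f ⟩
    ∑ m f + ∑ (n ∸ m) (λ i → f (m ℕ.+ i))       ≈⟨ +-congˡ (∑-zero (n ∸ m) tail≈0) ⟩
    ∑ m f + 0#                                  ≈⟨ +-identityʳ _ ⟩
    ∑ m f                                       ∎
    where
    tail≈0 : ∀ i → i < n ∸ m → f (m ℕ.+ i) ≈ 0#
    tail≈0 i i<n∸m = f≈0 (m ℕ.+ i) (ℕₚ.m≤m+n m i)
      (≡.subst (_≤ n) (ℕₚ.+-suc m i) (≡.subst (m ℕ.+ suc i ≤_) (ℕₚ.m+[n∸m]≡n m≤n) (ℕₚ.+-monoʳ-≤ m i<n∸m)))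

  ∑-single : ∀ n k (f : ℕ → Carrier) → k < n → (∀ i → i < n → i ≢ k → f i ≈ 0#) → ∑ n f ≈ f k
  ∑-single (suc n) k f k<1+n f≈0 with k ℕ.≟ n
  ... | yes ≡.refl = trans (+-congʳ (∑-zero n (λ i i<n → f≈0 i (ℕₚ.m<n⇒m<1+n i<n) (λ i≡n → ℕₚ.<-irrefl i≡n i<n))))
                           (+-identityˡ _)
  ... | no k≢n     = trans (+-cong (∑-single n k f (ℕₚ.≤∧≢⇒< (ℕₚ.≤-pred k<1+n) k≢n)
                                                   (λ i i<n → f≈0 i (ℕₚ.m<n⇒m<1+n i<n)))
                                   (f≈0 n ℕₚ.≤-refl (λ n≡k → k≢n (≡.sym n≡k))))
                           (+-identityʳ _)

  -- Formal power series

  FPS : Set r₁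
  FPS = D.FPS R

  infix  4 _≋_
  infixl 6 _⊖_
  infixl 7 _⊗_
  infixr 8 _·ₛ_

  _≋_ : FPS → FPS → Set r₂
  F ≋ G = ∀ n → F n ≈ G n

  _⊗_ : FPS → FPS → FPS
  _⊗_ = D._⊗_ R

  _⊖_ : FPS → FPS → FPS
  _⊖_ = D._⊖_ R

  _·ₛ_ : Carrier → FPS → FPS
  _·ₛ_ = D._·ₛ_ R

  qPow : ℕ → FPS
  qPow = D.qPow R

  oneS : FPS
  oneS = D.oneS R

  powS : FPS → ℕ → FPS
  powS = D.powS R

  recipS : FPS → FPS
  recipS = D.recipS R

  ≋-trans : ∀ {F G H} → F ≋ G → G ≋ H → F ≋ H
  ≋-trans F≋G G≋H n = trans (F≋G n) (G≋H n)

  when : ∀ {p} {P : Set p} → Dec P → Carrier → Carrier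
  when (yes _) x = x
  when (no _)  x = 0#

  when-yes : ∀ {p} {P : Set p} (P? : Dec P) → P → ∀ x → when P? x ≈ x
  when-yes (yes _) _ x = refl
  when-yes (no ¬p) p x = ⊥-elim (¬p p)

  when-no : ∀ {p} {P : Set p} (P? : Dec P) → ¬ P → ∀ x → when P? x ≈ 0#
  when-no (yes p) ¬p x = ⊥-elim (¬p p)
  when-no (no _)  _  x = refl

  when-cong : ∀ {p q} {P : Set p} {Q : Set q} → (P → Q) → (Q → P) →
              (P? : Dec P) (Q? : Dec Q) → ∀ {x y} → x ≈ y → when P? x ≈ when Q? y
  when-cong P⇒Q Q⇒P (yes p) (yes q) x≈y = x≈y
  when-cong P⇒Q Q⇒P (yes p) (no ¬q) x≈y = ⊥-elim (¬q (P⇒Q p))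
  when-cong P⇒Q Q⇒P (no ¬p) (yes q) x≈y = ⊥-elim (¬p (Q⇒P q))
  when-cong P⇒Q Q⇒P (no _)  (no _)  x≈y = refl

  when-congʳ : ∀ {p} {P : Set p} (P? : Dec P) {x y} → x ≈ y → when P? x ≈ when P? y
  when-congʳ (yes _) x≈y = x≈y
  when-congʳ (no _)  x≈y = refl

  ∑-when : ∀ n {p} {P : Set p} (P? : Dec P) (x f : ℕ → Carrier) →
           ∑ n (λ i → x i * when P? (f i)) ≈ when P? (∑ n (λ i → x i * f i))
  ∑-when n (yes _) x f = refl
  ∑-when n (no _)  x f = ∑-zero n (λ i _ → zeroʳ (x i))

  qPow-≢ : ∀ {a n} → n ≢ a → qPow a n ≈ 0#
  qPow-≢ {a} {n} n≢a with n ℕ.≟ a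
  ... | yes n≡a = ⊥-elim (n≢a n≡a)
  ... | no _    = refl

  qPow-≡ : ∀ a → qPow a a ≈ 1#
  qPow-≡ a with a ℕ.≟ a
  ... | yes _ = refl
  ... | no a≢a = ⊥-elim (a≢a ≡.refl)

  qPow-⊗ : ∀ a (F : FPS) n → (qPow a ⊗ F) n ≈ when (a ≤? n) (F (n ∸ a))
  qPow-⊗ a F n with a ≤? n
  ... | yes a≤n = trans (∑-single (suc n) a _ (s≤s a≤n) (λ i _ i≢a → trans (*-congʳ (qPow-≢ i≢a)) (zeroˡ _)))
                        (trans (*-congʳ (qPow-≡ a)) (*-identityˡ _))
  ... | no a≰n  = ∑-zero (suc n) (λ i i≤n →
                    trans (*-congʳ (qPow-≢ (λ i≡a → a≰n (≡.subst (_≤ n) i≡a (ℕₚ.≤-pred i≤n))))) (zeroˡ _))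

  oneS-⊗ : ∀ F → oneS ⊗ F ≋ F
  oneS-⊗ F n = trans (qPow-⊗ 0 F n) (when-yes (0 ≤? n) z≤n _)

  ⊗-cong : ∀ {F F′ G G′} → F ≋ F′ → G ≋ G′ → F ⊗ G ≋ F′ ⊗ G′
  ⊗-cong F≋F′ G≋G′ n = ∑-cong-∀ (suc n) (λ j → *-cong (F≋F′ j) (G≋G′ (n ∸ j)))

  ⊗-comm : ∀ F G → F ⊗ G ≋ G ⊗ F
  ⊗-comm F G n = trans (∑-reverse (suc n) _)
    (∑-cong (suc n) (λ i i≤n → trans (*-comm _ _) (*-congʳ (≡⇒≈ (≡.cong G (ℕₚ.m∸[m∸n]≡n (ℕₚ.≤-pred i≤n)))))))

  ⊗-oneS : ∀ F → F ⊗ oneS ≋ F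
  ⊗-oneS F = ≋-trans (⊗-comm F oneS) (oneS-⊗ F)

  ∑-triangle : ∀ n (f : ℕ → ℕ → Carrier) →
    ∑ (suc n) (λ j → ∑ (suc j) (f j)) ≈ ∑ (suc n) (λ l → ∑ (suc (n ∸ l)) (λ t → f (l ℕ.+ t) l))
  ∑-triangle zero    f = refl
  ∑-triangle (suc n) f = begin
    ∑ (suc n) (λ j → ∑ (suc j) (f j)) + (∑ (suc n) (f (suc n)) + f (suc n) (suc n))
      ≈⟨ +-congʳ (∑-triangle n f) ⟩
    ∑ (suc n) (λ l → ∑ (suc (n ∸ l)) (λ t → f (l ℕ.+ t) l)) + (∑ (suc n) (f (suc n)) + f (suc n) (suc n))
      ≈⟨ sym (+-assoc _ _ _) ⟩
    (∑ (suc n) (λ l → ∑ (suc (n ∸ l)) (λ t → f (l ℕ.+ t) l)) + ∑ (suc n) (f (suc n))) + f (suc n) (suc n)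
      ≈⟨ +-cong (sym (∑-distrib-+ (suc n) _ _)) diagonal ⟩
    ∑ (suc n) (λ l → ∑ (suc (n ∸ l)) (λ t → f (l ℕ.+ t) l) + f (suc n) l) + ∑ 1 (λ t → f (suc n ℕ.+ t) (suc n))
      ≈⟨ +-congʳ (∑-cong (suc n) (λ l l≤n → sym (row l (ℕₚ.≤-pred l≤n)))) ⟩
    ∑ (suc n) (λ l → ∑ (suc (suc n ∸ l)) (λ t → f (l ℕ.+ t) l)) + ∑ 1 (λ t → f (suc n ℕ.+ t) (suc n))
      ≈⟨ +-congˡ (≡⇒≈ (≡.cong (λ k → ∑ (suc k) (λ t → f (suc n ℕ.+ t) (suc n))) (≡.sym (ℕₚ.n∸n≡0 n)))) ⟩
    ∑ (suc n) (λ l → ∑ (suc (suc n ∸ l)) (λ t → f (l ℕ.+ t) l)) + ∑ (suc (suc n ∸ suc n)) (λ t → f (suc n ℕ.+ t) (suc n)) ∎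
    where
    diagonal : f (suc n) (suc n) ≈ ∑ 1 (λ t → f (suc n ℕ.+ t) (suc n))
    diagonal = trans (≡⇒≈ (≡.cong (λ k → f k (suc n)) (≡.sym (ℕₚ.+-identityʳ (suc n))))) (sym (+-identityˡ _))
    row : ∀ l → l ≤ n → ∑ (suc (suc n ∸ l)) (λ t → f (l ℕ.+ t) l) ≈ ∑ (suc (n ∸ l)) (λ t → f (l ℕ.+ t) l) + f (suc n) l
    row l l≤n = begin
      ∑ (suc (suc n ∸ l)) (λ t → f (l ℕ.+ t) l)
        ≈⟨ ≡⇒≈ (≡.cong (λ k → ∑ (suc k) (λ t → f (l ℕ.+ t) l)) (ℕₚ.+-∸-assoc 1 l≤n)) ⟩
      ∑ (suc (n ∸ l)) (λ t → f (l ℕ.+ t) l) + f (l ℕ.+ suc (n ∸ l)) l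
        ≈⟨ +-congˡ (≡⇒≈ (≡.cong (λ k → f k l) (≡.trans (ℕₚ.+-suc l (n ∸ l)) (≡.cong suc (ℕₚ.m+[n∸m]≡n l≤n))))) ⟩
      ∑ (suc (n ∸ l)) (λ t → f (l ℕ.+ t) l) + f (suc n) l ∎

  ⊗-assoc : ∀ F G H → (F ⊗ G) ⊗ H ≋ F ⊗ (G ⊗ H)
  ⊗-assoc F G H n = begin
    ∑ (suc n) (λ j → ∑ (suc j) (λ l → F l * G (j ∸ l)) * H (n ∸ j))
      ≈⟨ ∑-cong-∀ (suc n) (λ j → ∑-distribʳ (suc j) _ _) ⟩
    ∑ (suc n) (λ j → ∑ (suc j) (λ l → (F l * G (j ∸ l)) * H (n ∸ j)))
      ≈⟨ ∑-triangle n _ ⟩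
    ∑ (suc n) (λ l → ∑ (suc (n ∸ l)) (λ t → (F l * G (l ℕ.+ t ∸ l)) * H (n ∸ (l ℕ.+ t))))
      ≈⟨ ∑-cong-∀ (suc n) (λ l → ∑-cong-∀ (suc (n ∸ l)) (λ t → trans (*-assoc _ _ _)
           (*-congˡ (*-cong (≡⇒≈ (≡.cong G (ℕₚ.m+n∸m≡n l t))) (≡⇒≈ (≡.cong H (≡.sym (ℕₚ.∸-+-assoc n l t)))))))) ⟩
    ∑ (suc n) (λ l → ∑ (suc (n ∸ l)) (λ t → F l * (G t * H (n ∸ l ∸ t))))
      ≈⟨ ∑-cong-∀ (suc n) (λ l → sym (∑-distribˡ (suc (n ∸ l)) _ _)) ⟩
    ∑ (suc n) (λ l → F l * ∑ (suc (n ∸ l)) (λ t → G t * H (n ∸ l ∸ t))) ∎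

  ⊗-distribˡ-⊖ : ∀ F G H → F ⊗ (G ⊖ H) ≋ F ⊗ G ⊖ F ⊗ H
  ⊗-distribˡ-⊖ F G H n = trans (∑-cong-∀ (suc n) (λ j → x[y-z]≈xy-xz _ _ _)) (∑-distrib-- (suc n) _ _)

  ⊗-difference : ∀ F α β E₁ E₂ n → (F ⊗ (α ·ₛ E₁ ⊖ β ·ₛ E₂)) n ≈ α * (F ⊗ E₁) n - β * (F ⊗ E₂) n
  ⊗-difference F α β E₁ E₂ n =
    trans (⊗-distribˡ-⊖ F (α ·ₛ E₁) (β ·ₛ E₂) n) (+-cong (⊗-·ₛ α E₁) (-‿cong (⊗-·ₛ β E₂)))
    where
    ⊗-·ₛ : ∀ γ E → (F ⊗ (γ ·ₛ E)) n ≈ γ * (F ⊗ E) n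
    ⊗-·ₛ γ E = trans (∑-cong-∀ (suc n) (λ j → *-solve 3 (λ f c e → (f ∙ (c ∙ e)) ⊜ (c ∙ (f ∙ e))) refl (F j) γ (E (n ∸ j))))
                     (sym (∑-distribˡ (suc n) γ _))

  qPow-⊗-pred : ∀ c t (F : FPS) j → (qPow (c ℕ.+ t) ⊗ F) j ≈ when (t ≤? suc j) ((qPow (suc c) ⊗ F) (suc j ∸ t))
  qPow-⊗-pred c t F j = trans (qPow-⊗ (c ℕ.+ t) F j)
    (trans (shift (c ℕ.+ t ≤? j) (t ≤? suc j) (suc c ≤? suc j ∸ t))
           (when-congʳ (t ≤? suc j) (sym (qPow-⊗ (suc c) F (suc j ∸ t)))))
    where
    index : j ∸ (c ℕ.+ t) ≡ suc j ∸ t ∸ suc c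
    index = ≡.sym (≡.trans (ℕₚ.∸-+-assoc (suc j) t (suc c))
                    (≡.trans (≡.cong (suc j ∸_) (ℕₚ.+-suc t c)) (≡.cong (j ∸_) (ℕₚ.+-comm t c))))
    shift : (c+t≤? : Dec (c ℕ.+ t ≤ j)) (t≤? : Dec (t ≤ suc j)) (c<? : Dec (suc c ≤ suc j ∸ t)) →
      when c+t≤? (F (j ∸ (c ℕ.+ t))) ≈ when t≤? (when c<? (F (suc j ∸ t ∸ suc c)))
    shift (yes _)     (yes _)     (yes _)   = ≡⇒≈ (≡.cong F index)
    shift (yes c+t≤j) (yes _)     (no c≮)   = ⊥-elim (c≮ (ℕₚ.m+n≤o⇒m≤o∸n (suc c) (s≤s c+t≤j)))
    shift (yes c+t≤j) (no t≰)     _         = ⊥-elim (t≰ (ℕₚ.≤-trans (ℕₚ.m≤n+m t c) (ℕₚ.m≤n⇒m≤1+n c+t≤j)))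
    shift (no c+t≰j)  (yes t≤1+j) (yes c<) = ⊥-elim (c+t≰j (ℕₚ.≤-pred (ℕₚ.m≤o∸n⇒m+n≤o (suc c) t≤1+j c<)))
    shift (no _)      (yes _)     (no _)    = refl
    shift (no _)      (no _)      _         = refl

  ∑-reindex : ∀ x t (B E : ℕ → Carrier) → B 0 ≈ 0# →
    ∑ (suc x) (λ j → when (t ≤? suc j) (B (suc j ∸ t)) * E (x ∸ j)) ≈ ∑ (suc x ∸ t) (λ k → B (suc k) * E (x ∸ (k ℕ.+ t)))
  ∑-reindex x t B E B₀≈0 with ℕₚ.≤-<-connex t (suc x)
  ... | inj₁ t≤1+x = begin
    ∑ (suc x) f                     ≈⟨ ≡⇒≈ (≡.cong (λ n → ∑ n f) (≡.sym (ℕₚ.m+[n∸m]≡n t≤1+x))) ⟩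
    ∑ (t ℕ.+ (suc x ∸ t)) f         ≈⟨ ∑-dropZeros t (suc x ∸ t) f below-t ⟩
    ∑ (suc x ∸ t) (λ k → f (t ℕ.+ k)) ≈⟨ ∑-cong-∀ (suc x ∸ t) from-t ⟩
    ∑ (suc x ∸ t) (λ k → B (suc k) * E (x ∸ (k ℕ.+ t))) ∎
    where
    f : ℕ → Carrier
    f j = when (t ≤? suc j) (B (suc j ∸ t)) * E (x ∸ j)
    below-t : ∀ j → j < t → f j ≈ 0#
    below-t j j<t with t ≤? suc j
    ... | no _  = zeroˡ _
    ... | yes _ = trans (*-congʳ (trans (≡⇒≈ (≡.cong B (ℕₚ.m≤n⇒m∸n≡0 j<t))) B₀≈0)) (zeroˡ _)
    from-t : ∀ k → f (t ℕ.+ k) ≈ B (suc k) * E (x ∸ (k ℕ.+ t))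
    from-t k = *-cong (trans (when-yes (t ≤? suc (t ℕ.+ k)) (ℕₚ.m≤n⇒m≤1+n (ℕₚ.m≤m+n t k)) _)
                             (≡⇒≈ (≡.cong B (≡.trans (≡.cong (_∸ t) (≡.sym (ℕₚ.+-suc t k))) (ℕₚ.m+n∸m≡n t (suc k))))))
                      (≡⇒≈ (≡.cong (λ z → E (x ∸ z)) (ℕₚ.+-comm t k)))
  ... | inj₂ 1+x<t = trans (∑-zero (suc x) term≈0)
    (≡⇒≈ (≡.cong (λ n → ∑ n (λ k → B (suc k) * E (x ∸ (k ℕ.+ t)))) (≡.sym (ℕₚ.m≤n⇒m∸n≡0 (ℕₚ.<⇒≤ 1+x<t)))))
    where
    term≈0 : ∀ j → j < suc x → when (t ≤? suc j) (B (suc j ∸ t)) * E (x ∸ j) ≈ 0#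
    term≈0 j j≤x = trans (*-congʳ (when-no (t ≤? suc j) (λ t≤1+j → ℕₚ.<⇒≱ 1+x<t (ℕₚ.≤-trans t≤1+j j≤x)) _)) (zeroˡ _)

  -- Reciprocals

  infixl 6 _⊕_

  _⊕_ : FPS → FPS → FPS
  _⊕_ = D._⊕_ R

  geomS : FPS → FPS
  geomS = D.geomS R

  powS-vanishes : ∀ {u} → u 0 ≈ 0# → ∀ j k → k < j → powS u j k ≈ 0#
  powS-vanishes {u} u₀≈0 (suc j) k k<1+j = ∑-zero (suc k) term≈0
    where
    term≈0 : ∀ l → l < suc k → powS u j l * u (k ∸ l) ≈ 0#
    term≈0 l l≤k with ℕₚ.m≤n⇒m<n∨m≡n (ℕₚ.≤-pred l≤k)
    ... | inj₁ l<k    = trans (*-congʳ (powS-vanishes u₀≈0 j l (ℕₚ.<-≤-trans l<k (ℕₚ.≤-pred k<1+j)))) (zeroˡ _)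
    ... | inj₂ ≡.refl = trans (*-congˡ (trans (≡⇒≈ (≡.cong u (ℕₚ.n∸n≡0 l))) u₀≈0)) (zeroʳ _)

  geomS-fixpoint : ∀ {u} → u 0 ≈ 0# → geomS u ≋ oneS ⊕ geomS u ⊗ u
  geomS-fixpoint {u} u₀≈0 n = begin
    ∑ (suc n) (λ j → powS u j n)
      ≈⟨ ∑-head n _ ⟩
    oneS n + ∑ n (λ j → powS u (suc j) n)
      ≈⟨ +-congˡ (sym (∑-extend n (suc n) _ (ℕₚ.n≤1+n n) (λ j n≤j _ → powS-vanishes u₀≈0 (suc j) n (s≤s n≤j)))) ⟩
    oneS n + ∑ (suc n) (λ j → ∑ (suc n) (λ k → powS u j k * u (n ∸ k)))
      ≈⟨ +-congˡ (∑-comm (suc n) (suc n) _) ⟩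
    oneS n + ∑ (suc n) (λ k → ∑ (suc n) (λ j → powS u j k * u (n ∸ k)))
      ≈⟨ +-congˡ (∑-cong (suc n) (λ k k≤n → ∑-extend (suc k) (suc n) _ k≤n
           (λ j k<j _ → trans (*-congʳ (powS-vanishes u₀≈0 j k k<j)) (zeroˡ _)))) ⟩
    oneS n + ∑ (suc n) (λ k → ∑ (suc k) (λ j → powS u j k * u (n ∸ k)))
      ≈⟨ +-congˡ (∑-cong-∀ (suc n) (λ k → sym (∑-distribʳ (suc k) _ _))) ⟩
    oneS n + ∑ (suc n) (λ k → geomS u k * u (n ∸ k)) ∎

  -- The coefficient of q^n on the right-hand side involves G only below n.
  fixpoint-unique : ∀ {u G H} → u 0 ≈ 0# → G ≋ oneS ⊕ G ⊗ u → H ≋ oneS ⊕ H ⊗ u → G ≋ H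
  fixpoint-unique {u} {G} {H} u₀≈0 G≋ H≋ = <-rec (λ n → G n ≈ H n) step
    where
    step : ∀ n → (∀ {m} → m < n → G m ≈ H m) → G n ≈ H n
    step n G≈H = begin
      G n                                                          ≈⟨ G≋ n ⟩
      oneS n + (∑ n (λ k → G k * u (n ∸ k)) + G n * u (n ∸ n))      ≈⟨ +-congˡ (+-cong (∑-cong n (λ k k<n → *-congʳ (G≈H k<n)))
                                                                         (trans (last G) (sym (last H)))) ⟩
      oneS n + (∑ n (λ k → H k * u (n ∸ k)) + H n * u (n ∸ n))      ≈⟨ H≋ n ⟨
      H n                                                          ∎
      where
      last : ∀ F → F n * u (n ∸ n) ≈ 0#
      last F = trans (*-congˡ (trans (≡⇒≈ (≡.cong u (ℕₚ.n∸n≡0 n))) u₀≈0)) (zeroʳ _)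

  recipS-unique : ∀ {F H} → F 0 ≈ 1# → H ⊗ F ≋ oneS → recipS F ≋ H
  recipS-unique {F} {H} F₀≈1 H⊗F≋1 = fixpoint-unique {u} u₀≈0 (geomS-fixpoint {u} u₀≈0) H≋
    where
    u : FPS
    u = oneS ⊖ F
    u₀≈0 : u 0 ≈ 0#
    u₀≈0 = trans (+-cong (qPow-≡ 0) (-‿cong F₀≈1)) (-‿inverseʳ 1#)
    H≋ : H ≋ oneS ⊕ H ⊗ u
    H≋ n = sym (begin
      oneS n + (H ⊗ u) n                     ≈⟨ +-congˡ (⊗-distribˡ-⊖ H oneS F n) ⟩
      oneS n + ((H ⊗ oneS) n - (H ⊗ F) n)    ≈⟨ +-congˡ (+-cong (⊗-oneS H n) (-‿cong (H⊗F≋1 n))) ⟩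
      oneS n + (H n - oneS n)                ≈⟨ +-comm _ _ ⟩
      (H n - oneS n) + oneS n                ≈⟨ +-assoc _ _ _ ⟩
      H n + (- oneS n + oneS n)              ≈⟨ +-congˡ (-‿inverseˡ _) ⟩
      H n + 0#                               ≈⟨ +-identityʳ _ ⟩
      H n                                    ∎)

  powS-constant : ∀ {F} → F 0 ≈ 1# → ∀ K → powS F K 0 ≈ 1#
  powS-constant F₀≈1 zero    = qPow-≡ 0
  powS-constant F₀≈1 (suc K) = trans (+-identityˡ _) (trans (*-cong (powS-constant F₀≈1 K) F₀≈1) (*-identityˡ 1#))

  -- The coefficients of 1 / (1 - q^i)^(K+1)

  recipCoeff : (i : ℕ) .{{_ : NonZero i}} → ℕ → FPS
  recipCoeff i K n = when (i ∣? n) (natR ((n / i ℕ.+ K) C K))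

  module _ (i : ℕ) .{{_ : NonZero i}} where

    1-qⁱ : FPS
    1-qⁱ = oneS ⊖ qPow i

    ⊗-1-qⁱ : ∀ H n → (H ⊗ 1-qⁱ) n ≈ H n - when (i ≤? n) (H (n ∸ i))
    ⊗-1-qⁱ H n = trans (⊗-distribˡ-⊖ H oneS (qPow i) n)
      (+-cong (⊗-oneS H n) (-‿cong (trans (⊗-comm H (qPow i) n) (qPow-⊗ i H n))))

    i∤1+n : ∀ {n} → ¬ i ≤ suc n → ¬ i ∣ suc n
    i∤1+n i≰1+n i∣1+n = i≰1+n (∣⇒≤ i∣1+n)

    recipCoeff-at-0 : ∀ K → recipCoeff i K 0 ≈ 1#
    recipCoeff-at-0 K = begin
      recipCoeff i K 0             ≈⟨ when-yes (i ∣? 0) (i ∣0) _ ⟩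
      natR ((0 / i ℕ.+ K) C K)     ≈⟨ ≡⇒≈ (≡.cong (λ z → natR ((z ℕ.+ K) C K)) (0/n≡0 i)) ⟩
      natR (K C K)                 ≈⟨ ≡⇒≈ (≡.cong natR (nCn≡1 K)) ⟩
      1# + 0#                      ≈⟨ +-identityʳ 1# ⟩
      1#                           ∎

    ⊗-1-qⁱ-at-0 : ∀ H → (H ⊗ 1-qⁱ) 0 ≈ H 0
    ⊗-1-qⁱ-at-0 H = trans (⊗-1-qⁱ H 0) (trans (+-congˡ (-‿cong (when-no (i ≤? 0) i≰0 _))) (x-0#≈x _))
      where
      i≰0 : ¬ i ≤ 0
      i≰0 = ℕₚ.<⇒≱ (ℕ.>-nonZero⁻¹ i)

    recipCoeff0⊗1-qⁱ≋1 : recipCoeff i 0 ⊗ 1-qⁱ ≋ oneS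
    recipCoeff0⊗1-qⁱ≋1 zero    = trans (⊗-1-qⁱ-at-0 (recipCoeff i 0)) (trans (recipCoeff-at-0 0) (sym (qPow-≡ 0)))
    recipCoeff0⊗1-qⁱ≋1 (suc n) =
      trans (⊗-1-qⁱ (recipCoeff i 0) (suc n)) (trans (difference (i ≤? suc n)) (sym (qPow-≢ {0} {suc n} (λ ()))))
      where
      difference : (i≤? : Dec (i ≤ suc n)) →
        recipCoeff i 0 (suc n) - when i≤? (recipCoeff i 0 (suc n ∸ i)) ≈ 0#
      difference (yes i≤1+n) = trans (+-congˡ (-‿cong (when-yes (yes i≤1+n) i≤1+n _)))
        (trans (+-congʳ (when-cong (∣n⇒∣n∸m ∣-refl i≤1+n) (∣n∸m⇒∣n ∣-refl i≤1+n) (i ∣? suc n) (i ∣? (suc n ∸ i)) refl))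
               (-‿inverseʳ _))
      difference (no i≰1+n)  = trans (+-cong (when-no (i ∣? suc n) (i∤1+n i≰1+n) _) -0#≈0#) (+-identityʳ 0#)

    -- Pascal's rule, read at n / i and n / i - 1.
    recipCoeff[1+K]⊗1-qⁱ≋recipCoeffK : ∀ K → recipCoeff i (suc K) ⊗ 1-qⁱ ≋ recipCoeff i K
    recipCoeff[1+K]⊗1-qⁱ≋recipCoeffK K zero     =
      trans (⊗-1-qⁱ-at-0 (recipCoeff i (suc K))) (trans (recipCoeff-at-0 (suc K)) (sym (recipCoeff-at-0 K)))
    recipCoeff[1+K]⊗1-qⁱ≋recipCoeffK K (suc n′) =
      trans (⊗-1-qⁱ (recipCoeff i (suc K)) (suc n′)) (difference (i ≤? suc n′) (i ∣? suc n′))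
      where
      n : ℕ
      n = suc n′
      pascal : i ≤ n →
        natR ((n / i ℕ.+ suc K) C suc K) - natR (((n ∸ i) / i ℕ.+ suc K) C suc K) ≈ natR ((n / i ℕ.+ K) C K)
      pascal i≤n with n / i | m≥n⇒m/n>0 {n} {i} i≤n | [m∸n]/n≡m/n∸1 n i
      ... | suc q | _ | [n∸i]/i≡q = begin
        natR (suc (q ℕ.+ suc K) C suc K) - natR (((n ∸ i) / i ℕ.+ suc K) C suc K)
          ≈⟨ +-congˡ (-‿cong (≡⇒≈ (≡.cong (λ z → natR ((z ℕ.+ suc K) C suc K)) [n∸i]/i≡q))) ⟩
        natR (suc (q ℕ.+ suc K) C suc K) - natR ((q ℕ.+ suc K) C suc K)
          ≈⟨ +-congʳ (≡⇒≈ (≡.cong natR (≡.sym (nCk+nC[k+1]≡[n+1]C[k+1] (q ℕ.+ suc K) K)))) ⟩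
        natR ((q ℕ.+ suc K) C K ℕ.+ (q ℕ.+ suc K) C suc K) - natR ((q ℕ.+ suc K) C suc K)
          ≈⟨ +-congʳ (natR-+ ((q ℕ.+ suc K) C K) ((q ℕ.+ suc K) C suc K)) ⟩
        natR ((q ℕ.+ suc K) C K) + natR ((q ℕ.+ suc K) C suc K) - natR ((q ℕ.+ suc K) C suc K)
          ≈⟨ x+y-y≈x _ _ ⟩
        natR ((q ℕ.+ suc K) C K)
          ≈⟨ ≡⇒≈ (≡.cong (λ z → natR (z C K)) (ℕₚ.+-suc q K)) ⟩
        natR (suc (q ℕ.+ K) C K) ∎
      difference : (i≤? : Dec (i ≤ n)) (i∣? : Dec (i ∣ n)) →
        when i∣? (natR ((n / i ℕ.+ suc K) C suc K)) - when i≤? (recipCoeff i (suc K) (n ∸ i))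
          ≈ when i∣? (natR ((n / i ℕ.+ K) C K))
      difference (no i≰n)  (yes i∣n) = ⊥-elim (i∤1+n i≰n i∣n)
      difference (no i≰n)  (no _)    = x-0#≈x 0#
      difference (yes i≤n) (no i∤n)  =
        trans (+-congˡ (trans (-‿cong (when-no (i ∣? (n ∸ i)) (λ i∣n∸i → i∤n (∣n∸m⇒∣n ∣-refl i≤n i∣n∸i)) _)) -0#≈0#))
              (+-identityʳ 0#)
      difference (yes i≤n) (yes i∣n) =
        trans (+-congˡ (-‿cong (when-yes (i ∣? (n ∸ i)) (∣n⇒∣n∸m ∣-refl i≤n i∣n) _))) (pascal i≤n)

    recipCoeff-inverse : ∀ K → recipCoeff i K ⊗ powS 1-qⁱ (suc K) ≋ oneS
    recipCoeff-inverse zero    = ≋-trans (⊗-cong {recipCoeff i 0} (λ _ → refl) (oneS-⊗ 1-qⁱ)) recipCoeff0⊗1-qⁱ≋1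
    recipCoeff-inverse (suc K) =
      ≋-trans (⊗-cong {recipCoeff i (suc K)} (λ _ → refl) (⊗-comm (powS 1-qⁱ (suc K)) 1-qⁱ))
      (≋-trans (λ n → sym (⊗-assoc (recipCoeff i (suc K)) 1-qⁱ (powS 1-qⁱ (suc K)) n))
      (≋-trans (⊗-cong {G = powS 1-qⁱ (suc K)} (recipCoeff[1+K]⊗1-qⁱ≋recipCoeffK K) (λ _ → refl)) (recipCoeff-inverse K)))

    invPowS : ℕ → FPS
    invPowS K = recipS (powS 1-qⁱ (suc K))

    invPowS≋recipCoeff : ∀ K → invPowS K ≋ recipCoeff i K
    invPowS≋recipCoeff K = recipS-unique (powS-constant 1-qⁱ₀≈1 (suc K)) (recipCoeff-inverse K)
      where
      1-qⁱ₀≈1 : 1-qⁱ 0 ≈ 1#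
      1-qⁱ₀≈1 = trans (+-cong (qPow-≡ 0) (-‿cong (qPow-≢ (λ 0≡i → ℕ.≢-nonZero⁻¹ i (≡.sym 0≡i))))) (x-0#≈x 1#)

  invPowS-1 : ∀ r n → invPowS 1 r n ≈ natR ((n ℕ.+ r) C r)
  invPowS-1 r n = trans (invPowS≋recipCoeff 1 r n)
    (trans (when-yes (1 ∣? n) (1∣ n) _) (≡⇒≈ (≡.cong (λ z → natR ((z ℕ.+ r) C r)) (n/1≡n n))))

  -- Divisor sums as coefficients

  powR : Carrier → ℕ → Carrier
  powR = D.powR R

  weight : (ℕ → Carrier) → ℕ → ℕ → Carrier
  weight g e d = powR (natR d) e * g d

  -- The summand of Bg is local to its definition; unification against the unfolded sum recovers it.
  summand : ∀ {n} {x : Carrier} {f : ℕ → Carrier} → x ≡ ∑ n f → ℕ → Carrier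
  summand {f = f} _ = f

  Bg-summand : (g : ℕ → Carrier) (K a′ e y : ℕ) → ℕ → Carrier
  Bg-summand g K a′ e y = summand {n = y} {x = D.Bg R g K (suc a′) e y} ≡.refl

  qPow-⊗-invPowS : ∀ c d .{{_ : NonZero d}} K y →
    (qPow c ⊗ invPowS d K) y ≈ when (c ≤? y) (recipCoeff d K (y ∸ c))
  qPow-⊗-invPowS c d K y = trans (qPow-⊗ c (invPowS d K) y) (when-congʳ (c ≤? y) (invPowS≋recipCoeff d K (y ∸ c)))

  Bg-summand-coeff : ∀ g K a′ e y d′ →
    Bg-summand g K a′ e y d′ ≈ weight g e (suc d′) * (qPow (suc a′ ℕ.* suc d′) ⊗ invPowS (suc d′) K) y
  Bg-summand-coeff g K a′ e y d′ with (suc d′ ∣? y) ×-dec (suc d′ ≤? y / suc a′)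
  ... | yes (d∣y , d≤y/a) = begin
    ι (binom (+ (y / d) ℤ.- + a ℤ.+ + K) K) * powR (natR d) e * g d
      ≈⟨ *-congʳ (*-congʳ (≡⇒≈ (≡.cong ι binom≡))) ⟩
    natR ((((y ∸ a ℕ.* d) / d) ℕ.+ K) C K) * powR (natR d) e * g d
      ≈⟨ *-solve 3 (λ b p w → ((b ∙ p) ∙ w) ⊜ ((p ∙ w) ∙ b)) refl _ _ _ ⟩
    weight g e d * natR ((((y ∸ a ℕ.* d) / d) ℕ.+ K) C K)
      ≈⟨ *-congˡ (trans (when-yes (a ℕ.* d ≤? y) a*d≤y _)
                        (when-yes (d ∣? (y ∸ a ℕ.* d)) (∣n⇒∣n∸m (n∣m*n a) a*d≤y d∣y) _)) ⟨
    weight g e d * when (a ℕ.* d ≤? y) (recipCoeff d K (y ∸ a ℕ.* d))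
      ≈⟨ *-congˡ (qPow-⊗-invPowS (a ℕ.* d) d K y) ⟨
    weight g e d * (qPow (a ℕ.* d) ⊗ invPowS d K) y ∎
    where
    a d : ℕ
    a = suc a′
    d = suc d′
    a*d≤y : a ℕ.* d ≤ y
    a*d≤y = ≡.subst (_≤ y) (ℕₚ.*-comm d a) (m≤n/o⇒m*o≤n d≤y/a)
    binom≡ : binom (+ (y / d) ℤ.- + a ℤ.+ + K) K ≡ + ((((y ∸ a ℕ.* d) / d) ℕ.+ K) C K)
    binom≡ = ≡.trans (≡.cong (λ z → binom (z ℤ.+ + K) K) (≡.sym (+[m∸n]≡+m-+n (m*o≤n⇒m≤n/o a*d≤y))))
      (≡.trans (≡.cong (λ z → binom (+ (z ℕ.+ K)) K) (≡.sym ([m∸n*o]/o≡m/o∸n y a d))) (binom-pos _ K))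
  ... | no ¬cond = sym (trans (*-congˡ (trans (qPow-⊗-invPowS (a ℕ.* d) d K y) (coeff≈0 (a ℕ.* d ≤? y)))) (zeroʳ _))
    where
    a d : ℕ
    a = suc a′
    d = suc d′
    coeff≈0 : (a*d≤? : Dec (a ℕ.* d ≤ y)) → when a*d≤? (recipCoeff d K (y ∸ a ℕ.* d)) ≈ 0#
    coeff≈0 (no _)      = refl
    coeff≈0 (yes a*d≤y) = when-no (d ∣? (y ∸ a ℕ.* d))
      (λ d∣y∸a*d → ¬cond (∣n∸m⇒∣n (n∣m*n a) a*d≤y d∣y∸a*d ,
                          m*o≤n⇒m≤n/o (≡.subst (_≤ y) (ℕₚ.*-comm a d) a*d≤y))) _

  Bg≈∑-coeff : ∀ g K a′ e N y → y ≤ N →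
    ∑ N (λ i′ → weight g e (suc i′) * (qPow (suc a′ ℕ.* suc i′) ⊗ invPowS (suc i′) K) y) ≈ D.Bg R g K (suc a′) e y
  Bg≈∑-coeff g K a′ e N y y≤N = begin
    ∑ N (λ i′ → weight g e (suc i′) * (qPow (suc a′ ℕ.* suc i′) ⊗ invPowS (suc i′) K) y)
      ≈⟨ ∑-extend y N _ y≤N (λ i′ y≤i′ _ → trans (*-congˡ (vanishes i′ y≤i′)) (zeroʳ _)) ⟩
    ∑ y (λ i′ → weight g e (suc i′) * (qPow (suc a′ ℕ.* suc i′) ⊗ invPowS (suc i′) K) y)
      ≈⟨ ∑-cong-∀ y (λ d′ → sym (Bg-summand-coeff g K a′ e y d′)) ⟩
    D.Bg R g K (suc a′) e y ∎
    where
    vanishes : ∀ i′ → y ≤ i′ → (qPow (suc a′ ℕ.* suc i′) ⊗ invPowS (suc i′) K) y ≈ 0#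
    vanishes i′ y≤i′ = trans (qPow-⊗ (suc a′ ℕ.* suc i′) (invPowS (suc i′) K) y) (when-no (_ ≤? y) a*i≰y _)
      where
      a*i≰y : ¬ suc a′ ℕ.* suc i′ ≤ y
      a*i≰y a*i≤y = ℕₚ.<-irrefl ≡.refl (ℕₚ.≤-trans (ℕₚ.≤-trans (ℕₚ.m≤n*m (suc i′) (suc a′)) a*i≤y) y≤i′)

  shiftedInvPowS : ℕ → ℕ → ℕ → ℕ → FPS
  shiftedInvPowS a′ t K i′ = qPow (suc a′ ℕ.* suc i′ ℕ.+ t ∸ 1) ⊗ invPowS (suc i′) K

  ∑-shifted-coeff : ∀ g K a′ e t N x (E : FPS) → suc x ≤ N →
    ∑ N (λ i′ → weight g e (suc i′) * (shiftedInvPowS a′ t K i′ ⊗ E) x)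
      ≈ ∑ (suc x ∸ t) (λ k → D.Bg R g K (suc a′) e (suc k) * E (x ∸ (k ℕ.+ t)))
  ∑-shifted-coeff g K a′ e t N x E 1+x≤N = begin
    ∑ N (λ i′ → w i′ * ∑ (suc x) (λ j → X i′ j * E (x ∸ j)))
      ≈⟨ ∑-distribˡ-∑ N (suc x) w _ ⟩
    ∑ (suc x) (λ j → ∑ N (λ i′ → w i′ * (X i′ j * E (x ∸ j))))
      ≈⟨ ∑-cong-∀ (suc x) (λ j → trans (∑-cong-∀ N (λ i′ → sym (*-assoc _ _ _))) (sym (∑-distribʳ N _ _))) ⟩
    ∑ (suc x) (λ j → ∑ N (λ i′ → w i′ * X i′ j) * E (x ∸ j))
      ≈⟨ ∑-cong (suc x) (λ j j≤x → *-congʳ (column j j≤x)) ⟩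
    ∑ (suc x) (λ j → when (t ≤? suc j) (Bg (suc j ∸ t)) * E (x ∸ j))
      ≈⟨ ∑-reindex x t Bg E refl ⟩
    ∑ (suc x ∸ t) (λ k → Bg (suc k) * E (x ∸ (k ℕ.+ t))) ∎
    where
    w : ℕ → Carrier
    w i′ = weight g e (suc i′)
    X : ℕ → FPS
    X = shiftedInvPowS a′ t K
    Bg : ℕ → Carrier
    Bg = D.Bg R g K (suc a′) e
    column : ∀ j → j < suc x → ∑ N (λ i′ → w i′ * X i′ j) ≈ when (t ≤? suc j) (Bg (suc j ∸ t))
    -- a i ≥ 1, so the exponent a i + t - 1 of X is pred (a i) + t.
    column j j≤x = begin
      ∑ N (λ i′ → w i′ * X i′ j)
        ≈⟨ ∑-cong-∀ N (λ i′ → *-congˡ (qPow-⊗-pred (ℕ.pred (suc a′ ℕ.* suc i′)) t (invPowS (suc i′) K) j)) ⟩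
      ∑ N (λ i′ → w i′ * when (t ≤? suc j) ((qPow (suc a′ ℕ.* suc i′) ⊗ invPowS (suc i′) K) (suc j ∸ t)))
        ≈⟨ ∑-when N (t ≤? suc j) w _ ⟩
      when (t ≤? suc j) (∑ N (λ i′ → w i′ * (qPow (suc a′ ℕ.* suc i′) ⊗ invPowS (suc i′) K) (suc j ∸ t)))
        ≈⟨ when-congʳ (t ≤? suc j)
             (Bg≈∑-coeff g K a′ e N (suc j ∸ t) (ℕₚ.≤-trans (ℕₚ.m∸n≤m (suc j) t) (ℕₚ.≤-trans j≤x 1+x≤N))) ⟩
      when (t ≤? suc j) (Bg (suc j ∸ t)) ∎

  ∑-shifted-coeff-difference : ∀ g K a′ t N x u v e₁ e₂ (E₁ E₂ : FPS) → suc x ≤ N →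
    ∑ N (λ i′ → u * (weight g e₁ (suc i′) * (shiftedInvPowS a′ t K i′ ⊗ E₁) x)
              - v * (weight g e₂ (suc i′) * (shiftedInvPowS a′ t K i′ ⊗ E₂) x))
      ≈ ∑ (suc x ∸ t) (λ k → u * (D.Bg R g K (suc a′) e₁ (suc k) * E₁ (x ∸ (k ℕ.+ t)))
                           - v * (D.Bg R g K (suc a′) e₂ (suc k) * E₂ (x ∸ (k ℕ.+ t))))
  ∑-shifted-coeff-difference g K a′ t N x u v e₁ e₂ E₁ E₂ 1+x≤N =
    trans (∑-linear N u v _ _)
      (trans (+-cong (*-congˡ (∑-shifted-coeff g K a′ e₁ t N x E₁ 1+x≤N))
                     (-‿cong (*-congˡ (∑-shifted-coeff g K a′ e₂ t N x E₂ 1+x≤N))))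
             (sym (∑-linear (suc x ∸ t) u v _ _)))

  Sum4-term : ℕ → ℕ → ℕ → ℕ → ℕ → FPS
  Sum4-term s r p m i′ =
    (qPow (suc p ℕ.* suc i′ ℕ.+ r) ⊗ invPowS (suc i′) (s ∸ r))
      ⊗ (powR (natR (suc i′)) (suc m) ·ₛ invPowS 1 r ⊖ (natR (suc r) * powR (natR (suc i′)) m) ·ₛ invPowS 1 (suc r))

  Sum4-column : ∀ g s r p m N x → suc x ≤ N →
    ∑ N (λ i′ → g (suc i′) * (ι (D.C4 s r p m) * Sum4-term s r p m i′ x))
      ≈ ∑ (x ∸ r) (λ k → (ι (binom (+ x ℤ.- + suc k) r) * D.Bg R g (s ∸ r) (suc p) (suc m) (suc k)
                          - ι (binom (+ x ℤ.+ + 1 ℤ.- + suc k) (suc r) ℤ.* + suc r) * D.Bg R g (s ∸ r) (suc p) m (suc k))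
                         * ι (D.C4 s r p m))
  Sum4-column g s r p m N x 1+x≤N = begin
    ∑ N (λ i′ → g (suc i′) * (c * Sum4-term s r p m i′ x))
      ≈⟨ ∑-cong-∀ N summand≈ ⟩
    ∑ N (λ i′ → c * (weight g (suc m) (suc i′) * (X i′ ⊗ E₀) x) - (c * ρ) * (weight g m (suc i′) * (X i′ ⊗ E₁) x))
      ≈⟨ ∑-shifted-coeff-difference g K p (suc r) N x c (c * ρ) (suc m) m E₀ E₁ 1+x≤N ⟩
    ∑ (x ∸ r) (λ k → c * (Bg (suc m) (suc k) * E₀ (x ∸ (k ℕ.+ suc r))) - (c * ρ) * (Bg m (suc k) * E₁ (x ∸ (k ℕ.+ suc r))))
      ≈⟨ ∑-cong (x ∸ r) term≈ ⟩
    ∑ (x ∸ r) (λ k → (ι (binom (+ x ℤ.- + suc k) r) * Bg (suc m) (suc k)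
                      - ι (binom (+ x ℤ.+ + 1 ℤ.- + suc k) (suc r) ℤ.* + suc r) * Bg m (suc k)) * c) ∎
    where
    c ρ : Carrier
    c = ι (D.C4 s r p m)
    ρ = natR (suc r)
    K : ℕ
    K = s ∸ r
    E₀ E₁ : FPS
    E₀ = invPowS 1 r
    E₁ = invPowS 1 (suc r)
    X : ℕ → FPS
    X = shiftedInvPowS p (suc r) K
    Bg : ℕ → ℕ → Carrier
    Bg = D.Bg R g K (suc p)
    summand≈ : ∀ i′ → g (suc i′) * (c * Sum4-term s r p m i′ x)
                 ≈ c * (weight g (suc m) (suc i′) * (X i′ ⊗ E₀) x) - (c * ρ) * (weight g m (suc i′) * (X i′ ⊗ E₁) x)
    summand≈ i′ = begin
      g i * (c * Sum4-term s r p m i′ x)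
        ≈⟨ *-congˡ (*-congˡ (≡⇒≈ (≡.cong (λ z → ((qPow z ⊗ invPowS i K) ⊗ (α ·ₛ E₀ ⊖ (ρ * π) ·ₛ E₁)) x) exponent))) ⟩
      g i * (c * (X i′ ⊗ (α ·ₛ E₀ ⊖ (ρ * π) ·ₛ E₁)) x)
        ≈⟨ *-congˡ (*-congˡ (⊗-difference (X i′) α (ρ * π) E₀ E₁ x)) ⟩
      g i * (c * (α * (X i′ ⊗ E₀) x - (ρ * π) * (X i′ ⊗ E₁) x))
        ≈⟨ *-congˡ (x[y-z]≈xy-xz c _ _) ⟩
      g i * (c * (α * (X i′ ⊗ E₀) x) - c * ((ρ * π) * (X i′ ⊗ E₁) x))
        ≈⟨ x[y-z]≈xy-xz (g i) _ _ ⟩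
      g i * (c * (α * (X i′ ⊗ E₀) x)) - g i * (c * ((ρ * π) * (X i′ ⊗ E₁) x))
        ≈⟨ +-cong (*-solve 4 (λ g c α A → (g ∙ (c ∙ (α ∙ A))) ⊜ (c ∙ ((α ∙ g) ∙ A))) refl _ _ _ _)
                  (-‿cong (*-solve 5 (λ g c ρ π B → (g ∙ (c ∙ ((ρ ∙ π) ∙ B))) ⊜ ((c ∙ ρ) ∙ ((π ∙ g) ∙ B))) refl _ _ _ _ _)) ⟩
      c * (weight g (suc m) i * (X i′ ⊗ E₀) x) - (c * ρ) * (weight g m i * (X i′ ⊗ E₁) x) ∎
      where
      i : ℕ
      i = suc i′
      α π : Carrier
      α = powR (natR i) (suc m)
      π = powR (natR i) m
      exponent : suc p ℕ.* i ℕ.+ r ≡ suc p ℕ.* i ℕ.+ suc r ∸ 1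
      exponent = ≡.sym (≡.cong (_∸ 1) (ℕₚ.+-suc (suc p ℕ.* i) r))
    term≈ : ∀ k → k < x ∸ r →
      c * (Bg (suc m) (suc k) * E₀ (x ∸ (k ℕ.+ suc r))) - (c * ρ) * (Bg m (suc k) * E₁ (x ∸ (k ℕ.+ suc r)))
        ≈ (ι (binom (+ x ℤ.- + suc k) r) * Bg (suc m) (suc k)
           - ι (binom (+ x ℤ.+ + 1 ℤ.- + suc k) (suc r) ℤ.* + suc r) * Bg m (suc k)) * c
    term≈ k k<x∸r = begin
      c * (Bg (suc m) (suc k) * E₀ y) - (c * ρ) * (Bg m (suc k) * E₁ y)
        ≈⟨ +-cong (*-solve 3 (λ c B e → (c ∙ (B ∙ e)) ⊜ ((e ∙ B) ∙ c)) refl _ _ _)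
                  (-‿cong (*-solve 4 (λ c ρ B e → ((c ∙ ρ) ∙ (B ∙ e)) ⊜ (((e ∙ ρ) ∙ B) ∙ c)) refl _ _ _ _)) ⟩
      (E₀ y * Bg (suc m) (suc k)) * c - ((E₁ y * ρ) * Bg m (suc k)) * c
        ≈⟨ [y-z]x≈yx-zx c _ _ ⟨
      (E₀ y * Bg (suc m) (suc k) - (E₁ y * ρ) * Bg m (suc k)) * c
        ≈⟨ *-congʳ (+-cong (*-congʳ E₀-coeff) (-‿cong (*-congʳ E₁-coeff))) ⟩
      (ι (binom (+ x ℤ.- + suc k) r) * Bg (suc m) (suc k)
        - ι (binom (+ x ℤ.+ + 1 ℤ.- + suc k) (suc r) ℤ.* + suc r) * Bg m (suc k)) * c ∎
      where
      y : ℕ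
      y = x ∸ (k ℕ.+ suc r)
      k+1+r≤x : k ℕ.+ suc r ≤ x
      k+1+r≤x = ≡.subst (_≤ x) (≡.sym (ℕₚ.+-suc k r)) (m<n∸o⇒m+o<n k<x∸r)
      +y≡ : + y ≡ + x ℤ.- (+ k ℤ.+ (+ 1 ℤ.+ + r))
      +y≡ = +[m∸n]≡+m-+n k+1+r≤x
      shift₀ : ∀ X K Rr → X ℤ.- (+ 1 ℤ.+ K) ≡ (X ℤ.- (K ℤ.+ (+ 1 ℤ.+ Rr))) ℤ.+ Rr
      shift₀ = solve-∀
      shift₁ : ∀ X K Rr → X ℤ.+ + 1 ℤ.- (+ 1 ℤ.+ K) ≡ (X ℤ.- (K ℤ.+ (+ 1 ℤ.+ Rr))) ℤ.+ (+ 1 ℤ.+ Rr)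
      shift₁ = solve-∀
      E₀-coeff : E₀ y ≈ ι (binom (+ x ℤ.- + suc k) r)
      E₀-coeff = trans (invPowS-1 r y)
        (sym (ι-binom (y ℕ.+ r) r (≡.trans (shift₀ (+ x) (+ k) (+ r)) (≡.cong (ℤ._+ + r) (≡.sym +y≡)))))
      E₁-coeff : E₁ y * ρ ≈ ι (binom (+ x ℤ.+ + 1 ℤ.- + suc k) (suc r) ℤ.* + suc r)
      E₁-coeff = begin
        E₁ y * ρ                                       ≈⟨ *-congʳ (invPowS-1 (suc r) y) ⟩
        natR ((y ℕ.+ suc r) C suc r) * natR (suc r)    ≈⟨ natR-* ((y ℕ.+ suc r) C suc r) (suc r) ⟨
        ι (+ (((y ℕ.+ suc r) C suc r) ℕ.* suc r))      ≈⟨ ≡⇒≈ (≡.cong ι (ℤₚ.pos-* ((y ℕ.+ suc r) C suc r) (suc r))) ⟩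
        ι (+ ((y ℕ.+ suc r) C suc r) ℤ.* + suc r)
          ≈⟨ ≡⇒≈ (≡.cong (λ b → ι (b ℤ.* + suc r)) (≡.sym (binom-pos (y ℕ.+ suc r) (suc r)))) ⟩
        ι (binom (+ (y ℕ.+ suc r)) (suc r) ℤ.* + suc r)
          ≈⟨ ≡⇒≈ (≡.cong (λ z → ι (binom z (suc r) ℤ.* + suc r))
                          (≡.trans (≡.cong (ℤ._+ (+ 1 ℤ.+ + r)) +y≡) (≡.sym (shift₁ (+ x) (+ k) (+ r))))) ⟩
        ι (binom (+ x ℤ.+ + 1 ℤ.- + suc k) (suc r) ℤ.* + suc r) ∎

  Sum8-term : ℕ → ℕ → ℕ → ℕ → ℕ → FPS
  Sum8-term s r p n i′ =
    shiftedInvPowS (suc p) n (s ∸ r) i′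
      ⊗ (ι (binom (+ r) n) ·ₛ invPowS 1 r ⊖ ι (binom (+ suc r) n) ·ₛ invPowS 1 (suc r))

  Sum8-column : ∀ g s r p n w N x → suc x ≤ N →
    ∑ N (λ i′ → g (suc i′) * ((powR (natR (suc i′)) w * ι (D.C8 s r p n w)) * Sum8-term s r p n i′ x))
      ≈ ∑ (suc x ∸ n) (λ k → ι (binom (+ x ℤ.+ + 1 ℤ.- + n ℤ.- + suc k ℤ.+ + r) r ℤ.* binom (+ r) n
                                ℤ.- binom (+ x ℤ.+ + 2 ℤ.- + n ℤ.- + suc k ℤ.+ + r) (suc r) ℤ.* binom (+ suc r) n)
                              * ι (D.C8 s r p n w) * D.Bg R g (s ∸ r) (suc (suc p)) w (suc k))
  Sum8-column g s r p n w N x 1+x≤N = begin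
    ∑ N (λ i′ → g (suc i′) * ((powR (natR (suc i′)) w * c) * Sum8-term s r p n i′ x))
      ≈⟨ ∑-cong-∀ N summand≈ ⟩
    ∑ N (λ i′ → (c * β₀) * (weight g w (suc i′) * (X i′ ⊗ E₀) x) - (c * β₁) * (weight g w (suc i′) * (X i′ ⊗ E₁) x))
      ≈⟨ ∑-shifted-coeff-difference g K (suc p) n N x (c * β₀) (c * β₁) w w E₀ E₁ 1+x≤N ⟩
    ∑ (suc x ∸ n) (λ k → (c * β₀) * (Bg (suc k) * E₀ (x ∸ (k ℕ.+ n))) - (c * β₁) * (Bg (suc k) * E₁ (x ∸ (k ℕ.+ n))))
      ≈⟨ ∑-cong (suc x ∸ n) term≈ ⟩
    ∑ (suc x ∸ n) (λ k → ι (binom (+ x ℤ.+ + 1 ℤ.- + n ℤ.- + suc k ℤ.+ + r) r ℤ.* binom (+ r) n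
                            ℤ.- binom (+ x ℤ.+ + 2 ℤ.- + n ℤ.- + suc k ℤ.+ + r) (suc r) ℤ.* binom (+ suc r) n)
                          * c * Bg (suc k)) ∎
    where
    c β₀ β₁ : Carrier
    c = ι (D.C8 s r p n w)
    β₀ = ι (binom (+ r) n)
    β₁ = ι (binom (+ suc r) n)
    K : ℕ
    K = s ∸ r
    E₀ E₁ : FPS
    E₀ = invPowS 1 r
    E₁ = invPowS 1 (suc r)
    X : ℕ → FPS
    X = shiftedInvPowS (suc p) n K
    Bg : ℕ → Carrier
    Bg = D.Bg R g K (suc (suc p)) w
    summand≈ : ∀ i′ → g (suc i′) * ((powR (natR (suc i′)) w * c) * Sum8-term s r p n i′ x)
                 ≈ (c * β₀) * (weight g w (suc i′) * (X i′ ⊗ E₀) x) - (c * β₁) * (weight g w (suc i′) * (X i′ ⊗ E₁) x)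
    summand≈ i′ = begin
      g (suc i′) * ((π * c) * Sum8-term s r p n i′ x)
        ≈⟨ *-congˡ (*-congˡ (⊗-difference (X i′) β₀ β₁ E₀ E₁ x)) ⟩
      g (suc i′) * ((π * c) * (β₀ * (X i′ ⊗ E₀) x - β₁ * (X i′ ⊗ E₁) x))
        ≈⟨ *-congˡ (x[y-z]≈xy-xz (π * c) _ _) ⟩
      g (suc i′) * ((π * c) * (β₀ * (X i′ ⊗ E₀) x) - (π * c) * (β₁ * (X i′ ⊗ E₁) x))
        ≈⟨ x[y-z]≈xy-xz (g (suc i′)) _ _ ⟩
      g (suc i′) * ((π * c) * (β₀ * (X i′ ⊗ E₀) x)) - g (suc i′) * ((π * c) * (β₁ * (X i′ ⊗ E₁) x))
        ≈⟨ +-cong (regroup β₀ ((X i′ ⊗ E₀) x)) (-‿cong (regroup β₁ ((X i′ ⊗ E₁) x))) ⟩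
      (c * β₀) * (weight g w (suc i′) * (X i′ ⊗ E₀) x) - (c * β₁) * (weight g w (suc i′) * (X i′ ⊗ E₁) x) ∎
      where
      π : Carrier
      π = powR (natR (suc i′)) w
      regroup : ∀ β A → g (suc i′) * ((π * c) * (β * A)) ≈ (c * β) * ((π * g (suc i′)) * A)
      regroup β A = *-solve 5 (λ g π c β A → (g ∙ ((π ∙ c) ∙ (β ∙ A))) ⊜ ((c ∙ β) ∙ ((π ∙ g) ∙ A))) refl (g (suc i′)) π c β A
    term≈ : ∀ k → k < suc x ∸ n →
      (c * β₀) * (Bg (suc k) * E₀ (x ∸ (k ℕ.+ n))) - (c * β₁) * (Bg (suc k) * E₁ (x ∸ (k ℕ.+ n)))
        ≈ ι (binom (+ x ℤ.+ + 1 ℤ.- + n ℤ.- + suc k ℤ.+ + r) r ℤ.* binom (+ r) n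
             ℤ.- binom (+ x ℤ.+ + 2 ℤ.- + n ℤ.- + suc k ℤ.+ + r) (suc r) ℤ.* binom (+ suc r) n) * c * Bg (suc k)
    term≈ k k<1+x∸n = begin
      (c * β₀) * (Bg (suc k) * E₀ y) - (c * β₁) * (Bg (suc k) * E₁ y)
        ≈⟨ +-cong (regroup β₀ (E₀ y)) (-‿cong (regroup β₁ (E₁ y))) ⟩
      (E₀ y * β₀) * c * Bg (suc k) - (E₁ y * β₁) * c * Bg (suc k)
        ≈⟨ [y-z]x≈yx-zx (Bg (suc k)) _ _ ⟨
      ((E₀ y * β₀) * c - (E₁ y * β₁) * c) * Bg (suc k)
        ≈⟨ *-congʳ ([y-z]x≈yx-zx c _ _) ⟨
      (E₀ y * β₀ - E₁ y * β₁) * c * Bg (suc k)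
        ≈⟨ *-congʳ (*-congʳ coeff) ⟨
      ι (binom (+ x ℤ.+ + 1 ℤ.- + n ℤ.- + suc k ℤ.+ + r) r ℤ.* binom (+ r) n
         ℤ.- binom (+ x ℤ.+ + 2 ℤ.- + n ℤ.- + suc k ℤ.+ + r) (suc r) ℤ.* binom (+ suc r) n) * c * Bg (suc k) ∎
      where
      y : ℕ
      y = x ∸ (k ℕ.+ n)
      regroup : ∀ β e → (c * β) * (Bg (suc k) * e) ≈ (e * β) * c * Bg (suc k)
      regroup β e = *-solve 4 (λ c β B e → ((c ∙ β) ∙ (B ∙ e)) ⊜ (((e ∙ β) ∙ c) ∙ B)) refl c β (Bg (suc k)) e
      +y≡ : + y ≡ + x ℤ.- (+ k ℤ.+ + n)
      +y≡ = +[m∸n]≡+m-+n (ℕₚ.≤-pred (m<n∸o⇒m+o<n k<1+x∸n))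
      shift₀ : ∀ X N K Rr → X ℤ.+ + 1 ℤ.- N ℤ.- (+ 1 ℤ.+ K) ℤ.+ Rr ≡ (X ℤ.- (K ℤ.+ N)) ℤ.+ Rr
      shift₀ = solve-∀
      shift₁ : ∀ X N K Rr → X ℤ.+ + 2 ℤ.- N ℤ.- (+ 1 ℤ.+ K) ℤ.+ Rr ≡ (X ℤ.- (K ℤ.+ N)) ℤ.+ (+ 1 ℤ.+ Rr)
      shift₁ = solve-∀
      c₀ c₁ c₂ c₃ : ℕ
      c₀ = (y ℕ.+ r) C r
      c₁ = (y ℕ.+ suc r) C suc r
      c₂ = r C n
      c₃ = suc r C n
      integer : binom (+ x ℤ.+ + 1 ℤ.- + n ℤ.- + suc k ℤ.+ + r) r ℤ.* binom (+ r) n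
                ℤ.- binom (+ x ℤ.+ + 2 ℤ.- + n ℤ.- + suc k ℤ.+ + r) (suc r) ℤ.* binom (+ suc r) n
                ≡ + (c₀ ℕ.* c₂) ℤ.- + (c₁ ℕ.* c₃)
      integer = ≡.cong₂ ℤ._-_ (binom*binom≡+ (y ℕ.+ r) r r n index₀) (binom*binom≡+ (y ℕ.+ suc r) (suc r) (suc r) n index₁)
        where
        index₀ : + x ℤ.+ + 1 ℤ.- + n ℤ.- + suc k ℤ.+ + r ≡ + (y ℕ.+ r)
        index₀ = ≡.trans (shift₀ (+ x) (+ n) (+ k) (+ r)) (≡.cong (ℤ._+ + r) (≡.sym +y≡))
        index₁ : + x ℤ.+ + 2 ℤ.- + n ℤ.- + suc k ℤ.+ + r ≡ + (y ℕ.+ suc r)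
        index₁ = ≡.trans (shift₁ (+ x) (+ n) (+ k) (+ r)) (≡.cong (ℤ._+ + suc r) (≡.sym +y≡))
      coeff : ι (binom (+ x ℤ.+ + 1 ℤ.- + n ℤ.- + suc k ℤ.+ + r) r ℤ.* binom (+ r) n
                 ℤ.- binom (+ x ℤ.+ + 2 ℤ.- + n ℤ.- + suc k ℤ.+ + r) (suc r) ℤ.* binom (+ suc r) n)
              ≈ E₀ y * β₀ - E₁ y * β₁
      coeff = begin
        ι (binom (+ x ℤ.+ + 1 ℤ.- + n ℤ.- + suc k ℤ.+ + r) r ℤ.* binom (+ r) n
           ℤ.- binom (+ x ℤ.+ + 2 ℤ.- + n ℤ.- + suc k ℤ.+ + r) (suc r) ℤ.* binom (+ suc r) n)
          ≈⟨ ≡⇒≈ (≡.cong ι integer) ⟩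
        ι (+ (c₀ ℕ.* c₂) ℤ.- + (c₁ ℕ.* c₃))           ≈⟨ ι[+m-+n] (c₀ ℕ.* c₂) (c₁ ℕ.* c₃) ⟩
        natR (c₀ ℕ.* c₂) - natR (c₁ ℕ.* c₃)           ≈⟨ +-cong (natR-* c₀ c₂) (-‿cong (natR-* c₁ c₃)) ⟩
        natR c₀ * natR c₂ - natR c₁ * natR c₃
          ≈⟨ +-cong (*-cong (invPowS-1 r y) (ι-binom r n ≡.refl))
                    (-‿cong (*-cong (invPowS-1 (suc r) y) (ι-binom (suc r) n ≡.refl))) ⟨
        E₀ y * β₀ - E₁ y * β₁                         ∎

  S4partial≈RHS4 : ∀ g s x N → suc x ≤ N → S4partial R g s N x ≈ RHS4 R g s x
  S4partial≈RHS4 g s x N 1+x≤N =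
    ∑-distribˡ-∑-cong N (suc s) gᵢ _ _ λ r →
    ∑-distribˡ-∑-cong N (suc s) gᵢ _ _ λ p →
    ∑-distribˡ-∑-cong N (suc s) gᵢ _ _ λ m →
    Sum4-column g s r p m N x 1+x≤N
    where
    gᵢ : ℕ → Carrier
    gᵢ i′ = g (suc i′)

  S8partial≈RHS8 : ∀ g s x N → suc x ≤ N → S8partial R g s N x ≈ RHS8 R g s x
  S8partial≈RHS8 g s x N 1+x≤N =
    ∑-distribˡ-∑-cong N (suc s) gᵢ _ _ λ r →
    ∑-distribˡ-∑-cong N (suc s) gᵢ _ _ λ p →
    trans (∑-distribˡ-∑-cong N (suc (suc r)) gᵢ _ _ λ n →
           ∑-distribˡ-∑-cong N (suc s) gᵢ _ _ λ w →
           Sum8-column g s r p n w N x 1+x≤N)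
          (∑-comm (suc (suc r)) (suc s) _)
    where
    gᵢ : ℕ → Carrier
    gᵢ i′ = g (suc i′)

mainTheorem2 : ∀ {c ℓ : Level} (R : CommutativeRing c ℓ)
    (g : ℕ → CommutativeRing.Carrier R)
    (s : ℕ) → 1 ≤ s → (x : ℕ) → 1 ≤ x →
    (∃ λ N₀ → ∀ N → N₀ ≤ N →
      CommutativeRing._≈_ R (S4partial R g s N x) (RHS4 R g s x))
    × (∃ λ N₀ → ∀ N → N₀ ≤ N →
      CommutativeRing._≈_ R (S8partial R g s N x) (RHS8 R g s x))
mainTheorem2 R g s _ x _ = (suc x , S4partial≈RHS4 R g s x) , (suc x , S8partial≈RHS8 R g s x)
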